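{- Let $T$ be a tree with $n\ge1$ vertices and let $\ell\ge n$ be an integer. Then the vertices of the polytope $P_\ell(T)$ are exactly the near-minimally self-reachable configurations on $T$ with $\ell$ chips.
   Context: Label the vertices $v_1,\dots,v_n$; $e_i$ is the $i$th standard basis vector. A chip configuration on $T$ is a vector $c\in\mathbb{Z}_{\ge0}^n$ ($c_i$ chips on $v_i$). The Laplacian $\Delta(T)$ has $\Delta_{ii}=\deg(v_i)$, $\Delta_{ij}=-1$ if $v_iv_j$ is an edge, $0$ otherwise; firing $v_i$ from $c$ produces $c-\Delta(T)e_i$, legal if $c_i\ge\deg(v_i)$. A configuration is self-reachable on $T$ if some nonempty finite sequence of legal firings starting from it returns to it. (Known: equivalently, it has at least $m-1$ chips on every $m$-vertex subtree of $T$.) A minimally self-reachable configuration is a self-reachable one with exactly $n-1$ chips. A configuration $\nu$ is near-minimally self-reachable on $T$ if it is self-reachable and not minimally self-reachable, and there is a unique $i\in\{1,\dots,n\}$ such that $\nu-e_i$ is a self-reachable configuration on $T$; $\nu$ is then called near-minimally self-reachable about $v_i$. $S_\ell^{(T)}$ is the set of self-reachable configurations with exactly $\ell$ chips and $P_\ell(T)=\mathrm{conv}(S_\ell^{(T)})$.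
   Formalization: The polytope $P_\ell(T)$ is taken over the rationals: its points have rational coordinates, convex combinations have rational weights, and its vertices are the points extreme among rational points. -}

module Defs where

open import Data.Nat as ℕ using (ℕ; zero; suc; _∸_; _≤_)
open import Data.Bool using (Bool; true; false; if_then_else_)
open import Data.Fin using (Fin; _≟_)
open import Data.Vec as V using (Vec; lookup; tabulate)
open import Data.List using (List; []; _∷_; _++_; [_])
open import Data.List.Relation.Unary.All using (All)
open import Data.List.Relation.Unary.Linked using (Linked)
open import Data.List.Relation.Unary.Unique.Propositional using (Unique)
open import Data.Product using (Σ; ∃; _×_; _,_)
open import Data.Integer using (+_)
open import Data.Rational as Q using (ℚ; 0ℚ; 1ℚ; _/_)
open import Relation.Nullary using (¬_)
open import Relation.Nullary.Decidable using (⌊_⌋)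
open import Relation.Binary.PropositionalEquality using (_≡_)

record Graph (n : ℕ) : Set where
  field
    adj     : Fin n → Fin n → Bool
    adj-sym : ∀ i j → adj i j ≡ adj j i
    adj-irr : ∀ i → adj i i ≡ false

open Graph public

Adj : ∀ {n} → Graph n → Fin n → Fin n → Set
Adj G i j = adj G i j ≡ true

data Walk {n} (G : Graph n) : Fin n → Fin n → Set where
  here : ∀ {i} → Walk G i i
  step : ∀ {i k j} → Adj G i k → Walk G k j → Walk G i j

Connected : ∀ {n} → Graph n → Set
Connected G = ∀ i j → Walk G i j

HasCycle : ∀ {n} → Graph n → Set
HasCycle G = Σ (Fin _) λ u → Σ (Fin _) λ v → Σ (Fin _) λ w → Σ (List (Fin _)) λ rest →
  Unique (u ∷ v ∷ w ∷ rest) × Linked (Adj G) ((u ∷ v ∷ w ∷ rest) ++ [ u ])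

IsTree : ∀ {n} → Graph n → Set
IsTree G = Connected G × ¬ HasCycle G

Config : ℕ → Set
Config n = Vec ℕ n

deg : ∀ {n} → Graph n → Fin n → ℕ
deg G i = V.sum (tabulate λ j → if adj G i j then 1 else 0)

fire : ∀ {n} → Graph n → Fin n → Config n → Config n
fire G i c = tabulate λ j →
  if ⌊ j ≟ i ⌋ then lookup c i ∸ deg G i
  else (if adj G i j then suc (lookup c j) else lookup c j)

Legal : ∀ {n} → Graph n → Fin n → Config n → Set
Legal G i c = deg G i ≤ lookup c i

data LegalSeq {n} (G : Graph n) : Config n → List (Fin n) → Config n → Set where
  done : ∀ {c} → LegalSeq G c [] c
  _∷_  : ∀ {c i σ c'} → Legal G i c → LegalSeq G (fire G i c) σ c' → LegalSeq G c (i ∷ σ) c'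

SelfReachable : ∀ {n} → Graph n → Config n → Set
SelfReachable G c = Σ (Fin _) λ i → Σ (List (Fin _)) λ σ → LegalSeq G c (i ∷ σ) c

chips : ∀ {n} → Config n → ℕ
chips = V.sum

MinimallySelfReachable : ∀ {n} → Graph n → Config n → Set
MinimallySelfReachable {n} G c = SelfReachable G c × chips c ≡ n ∸ 1

-- ν - e_i (only meaningful when 1 ≤ ν_i)
minusE : ∀ {n} → Config n → Fin n → Config n
minusE c i = V.updateAt c i (λ x → x ∸ 1)

RemovableAt : ∀ {n} → Graph n → Config n → Fin n → Set
RemovableAt G c i = 1 ≤ lookup c i × SelfReachable G (minusE c i)

NearMinSRAbout : ∀ {n} → Graph n → Config n → Fin n → Set
NearMinSRAbout G c i =
  SelfReachable G c × ¬ MinimallySelfReachable G c ×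
  RemovableAt G c i × (∀ j → RemovableAt G c j → j ≡ i)

NearMinSR : ∀ {n} → Graph n → Config n → Set
NearMinSR G c = ∃ λ i → NearMinSRAbout G c i

toℚ : ℕ → ℚ
toℚ k = + k / 1

embed : ∀ {n} → Config n → Vec ℚ n
embed = V.map toℚ

InS : ∀ {n} → Graph n → ℕ → Vec ℚ n → Set
InS G ℓ p = Σ (Config _) λ c → SelfReachable G c × chips c ≡ ℓ × p ≡ embed c

_·_ : ∀ {n} → ℚ → Vec ℚ n → Vec ℚ n
t · p = V.map (t Q.*_) p

_⊕_ : ∀ {n} → Vec ℚ n → Vec ℚ n → Vec ℚ n
_⊕_ = V.zipWith Q._+_

weights : ∀ {n} → List (ℚ × Vec ℚ n) → ℚ
weights [] = 0ℚ
weights ((w , _) ∷ ws) = w Q.+ weights ws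

combo : ∀ {n} → List (ℚ × Vec ℚ n) → Vec ℚ n
combo [] = V.replicate _ 0ℚ
combo ((w , p) ∷ ws) = (w · p) ⊕ combo ws

InConv : ∀ {n} → (Vec ℚ n → Set) → Vec ℚ n → Set
InConv {n} S x = Σ (List (ℚ × Vec ℚ n)) λ ws →
  All (λ wp → (0ℚ Q.≤ Data.Product.proj₁ wp) × S (Data.Product.proj₂ wp)) ws ×
  weights ws ≡ 1ℚ × x ≡ combo ws

P : ∀ {n} → Graph n → ℕ → Vec ℚ n → Set
P G ℓ = InConv (InS G ℓ)

IsVertex : ∀ {n} → (Vec ℚ n → Set) → Vec ℚ n → Set
IsVertex K x = K x × (∀ y z t → K y → K z → 0ℚ Q.< t → t Q.< 1ℚ →
  x ≡ (t · y) ⊕ ((1ℚ Q.- t) · z) → y ≡ z)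

{-# OPTIONS --safe #-}
-- A configuration is self-reachable iff some injective ranking of the vertices leaves every vertex
-- at least as many chips as it has higher-ranked neighbours: fire each vertex once in increasing
-- rank, or conversely rank the vertices by their last firing. A ranking orients each edge once, and a
-- tree has n - 1 edges, so with ℓ ≥ n chips some vertex v has a spare chip and ν - e_v is again
-- self-reachable. If two vertices i ≠ j can both lose a chip, ν is the midpoint of ν - e_i + e_j and
-- ν - e_j + e_i, so it is not a vertex. If only i can, take a ranking for ν - e_i: it is tight away
-- from i, and i lies below all its neighbours (otherwise lifting the branch at a lower neighbour j
-- would free a chip at j). Shifted to weights ω with ω_i = 0, it makes ν the unique minimiser of
-- Σ ω_v c_v on S_ℓ: for any c with ranking κ this sum is at least Σ ω_v outdeg_κ(v), which charges
-- each edge one endpoint's weight and is therefore smallest, and only attained, for κ ordered like ω.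
module Submission where

open import Defs
open import Algebra.Bundles using (Ring)
import Algebra.Properties.Semiring.Sum as SemiringSum
open import Data.Bool using (Bool; true; false; if_then_else_; _∧_; _∨_; not) renaming (_≟_ to _≟ᵇ_)
open import Data.Bool.Properties using (∧-identityʳ; ∧-zeroʳ; ∨-identityʳ; ∨-zeroʳ; ∨-idem; not-involutive)
open import Data.Empty using (⊥-elim)
open import Data.Fin as F using (Fin; zero; suc; toℕ)
open import Data.Fin.Properties using (any?; toℕ-injective; toℕ<n)
import Data.Integer as ℤ
import Data.Integer.Properties as ℤP
open import Data.Integer.Tactic.RingSolver using () renaming (solve-∀ to ℤ-solve-∀)
open import Data.List using (List; []; _∷_; _++_; [_])
import Data.List.Membership.DecPropositional as DecMembership
open import Data.List.Membership.Propositional using (_∈_)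
open import Data.List.Relation.Unary.All using (All; []; _∷_)
open import Data.List.Relation.Unary.All.Properties using (¬Any⇒All¬)
open import Data.List.Relation.Unary.AllPairs using ([]; _∷_)
open import Data.List.Relation.Unary.Any using (here; there)
open import Data.List.Relation.Unary.Linked as Linked using (Linked; []; [-]; _∷_)
open import Data.List.Relation.Unary.Unique.Propositional using (Unique)
open import Data.Nat using (ℕ; zero; suc; _+_; _*_; _∸_; _≤_; _<_; z≤n; s≤s; _<?_)
open import Data.Nat.DivMod using (_%_; [m+kn]%n≡m%n; m<n⇒m%n≡m)
open import Data.Nat.Properties
open import Data.Nat.Tactic.RingSolver using (solve-∀)
open import Data.Product as Product using (Σ; ∃-syntax; _×_; _,_; proj₁; proj₂)
open import Data.Rational as Q using (ℚ; 0ℚ; 1ℚ; ½; 1/_; toℚᵘ)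
import Data.Rational.Properties as QP
open import Data.Rational.Solver using (module +-*-Solver)
open import Data.Rational.Unnormalised as ℚᵘ using (ℚᵘ; mkℚᵘ; *≡*; *≤*) renaming (_≃_ to _≃ᵘ_)
import Data.Rational.Unnormalised.Properties as ℚᵘP
open import Data.Sum using (_⊎_; inj₁; inj₂)
open import Data.Vec as V using (Vec; lookup; tabulate; updateAt)
open import Data.Vec.Properties
  using (lookup∘tabulate; tabulate∘lookup; tabulate-cong; lookup-map; lookup-zipWith; lookup-replicate; lookup∘updateAt; lookup∘updateAt′)
open import Data.Vec.Relation.Binary.Pointwise.Extensional using (ext; Pointwise-≡⇒≡)
open import Function using (_∘_; case_of_)
open import Function.Bundles using (_⇔_; mk⇔)
open import Function.Definitions using (Injective)
open import Relation.Binary.Construct.Closure.ReflexiveTransitive as Star using (Star; ε; _◅_; _◅◅_)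
open import Relation.Binary.Definitions using (DecidableEquality; tri<; tri≈; tri>)
open import Relation.Binary.PropositionalEquality hiding ([_])
open import Relation.Nullary using (¬_; Dec; yes; no; does; _⊎-dec_; _×-dec_)
open import Relation.Nullary.Decidable using (⌊_⌋; isYes≗does; dec-true; dec-false; from-yes)

-- Finite sums

module ℕ∑ = SemiringSum +-*-semiring
module ℚ∑ = SemiringSum (Ring.semiring QP.+-*-ring)
open ℕ∑ using (sum; sum-cong-≗)

sum-mono-≤ : ∀ {n} {f g : Fin n → ℕ} → (∀ i → f i ≤ g i) → sum f ≤ sum g
sum-mono-≤ {zero}  f≤g = z≤n
sum-mono-≤ {suc n} f≤g = +-mono-≤ (f≤g zero) (sum-mono-≤ (f≤g ∘ suc))

≤-sum : ∀ {n} (f : Fin n → ℕ) i → f i ≤ sum f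
≤-sum f zero    = m≤m+n _ _
≤-sum f (suc i) = ≤-trans (≤-sum (f ∘ suc) i) (m≤n+m _ (f zero))

sum-rigid : ∀ {n} {f g : Fin n → ℕ} → (∀ i → f i ≤ g i) → sum g ≤ sum f → ∀ i → f i ≡ g i
sum-rigid {f = f} {g} f≤g g≤f zero = ≤-antisym (f≤g zero)
  (+-cancelʳ-≤ _ _ _ (≤-trans (+-monoʳ-≤ (g zero) (sum-mono-≤ (f≤g ∘ suc))) g≤f))
sum-rigid {f = f} {g} f≤g g≤f (suc i) = sum-rigid (f≤g ∘ suc)
  (+-cancelˡ-≤ (g zero) _ _ (≤-trans g≤f (+-monoˡ-≤ _ (f≤g zero)))) i

sum-pick : ∀ {n} (k : Fin n) (g : Fin n → ℕ) → sum (λ j → if does (j F.≟ k) then g j else 0) ≡ g k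
sum-pick {suc n} zero    g = trans (cong (g zero +_) (ℕ∑.sum-replicate-zero n)) (+-identityʳ _)
sum-pick {suc n} (suc k) g = sum-pick k (g ∘ suc)

sum-ones : ∀ n → sum {n} (λ _ → 1) ≡ n
sum-ones zero    = refl
sum-ones (suc n) = cong suc (sum-ones n)

sum-agreeing-off : ∀ {n} {f g : Fin n → ℕ} i → (∀ v → v ≢ i → f v ≡ g v) → sum f + g i ≡ sum g + f i
sum-agreeing-off {suc n} {f} {g} zero f≡g =
  trans (cong (λ s → f zero + s + g zero) (sum-cong-≗ (λ v → f≡g (suc v) λ ())))
        (swap (f zero) (sum (g ∘ suc)) (g zero))
  where
  swap : ∀ a s b → a + s + b ≡ b + s + a
  swap = solve-∀
sum-agreeing-off {suc n} {f} {g} (suc i) f≡g =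
  trans (+-assoc (f zero) _ _)
        (trans (cong₂ _+_ (f≡g zero λ ()) (sum-agreeing-off i (λ v v≢i → f≡g (suc v) (λ { refl → v≢i refl }))))
               (sym (+-assoc (g zero) _ _)))

sum-transpose-right : ∀ {n} (f g : Fin n → Fin n → ℕ) →
                      sum (λ v → sum λ w → f v w + g w v) ≡ sum (λ v → sum λ w → f v w + g v w)
sum-transpose-right {n} f g = begin
  sum (λ v → sum λ w → f v w + g w v)                  ≡⟨ sum-cong-≗ (λ v → ℕ∑.∑-distrib-+ (f v) (λ w → g w v)) ⟩
  sum (λ v → sum (f v) + sum λ w → g w v)              ≡⟨ ℕ∑.∑-distrib-+ (λ v → sum (f v)) (λ v → sum λ w → g w v) ⟩
  sum (λ v → sum (f v)) + sum (λ v → sum λ w → g w v)  ≡⟨ cong (sum (λ v → sum (f v)) +_) (ℕ∑.∑-comm (λ v w → g w v)) ⟩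
  sum (λ v → sum (f v)) + sum (λ v → sum (g v))        ≡⟨ ℕ∑.∑-distrib-+ (λ v → sum (f v)) (λ v → sum (g v)) ⟨
  sum (λ v → sum (f v) + sum (g v))                    ≡⟨ sum-cong-≗ (λ v → ℕ∑.∑-distrib-+ (f v) (g v)) ⟨
  sum (λ v → sum λ w → f v w + g v w)                  ∎
  where open ≡-Reasoning

sum-tabulate : ∀ {n} (f : Fin n → ℕ) → V.sum (tabulate f) ≡ sum f
sum-tabulate {zero}  f = refl
sum-tabulate {suc n} f = cong (f zero +_) (sum-tabulate (f ∘ suc))

chips≡sum : ∀ {n} (c : Config n) → chips c ≡ sum (lookup c)
chips≡sum c = trans (cong V.sum (sym (tabulate∘lookup c))) (sum-tabulate (lookup c))

-- Graphs and firing schedules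

χ : Bool → ℕ
χ b = if b then 1 else 0

χ≤1 : ∀ b → χ b ≤ 1
χ≤1 true  = ≤-refl
χ≤1 false = z≤n

-- Comparisons of ranks are tested with ⌊_⌋ rather than does: does (m <? n) computes to m <ᵇ n,
-- which `with m <? n` can then no longer abstract.
⌊⌋-yes : ∀ {A : Set} (a? : Dec A) → A → ⌊ a? ⌋ ≡ true
⌊⌋-yes a? a = trans (isYes≗does a?) (dec-true a? a)

⌊⌋-no : ∀ {A : Set} (a? : Dec A) → ¬ A → ⌊ a? ⌋ ≡ false
⌊⌋-no a? ¬a = trans (isYes≗does a?) (dec-false a? ¬a)

⌊+-<?⌋ : ∀ m a b → ⌊ m + a <? m + b ⌋ ≡ ⌊ a <? b ⌋
⌊+-<?⌋ m a b with a <? b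
... | yes a<b = ⌊⌋-yes (_ <? _) (+-monoʳ-< m a<b)
... | no a≮b  = ⌊⌋-no (_ <? _) (a≮b ∘ +-cancelˡ-< m _ _)

≟-refl : ∀ {n} (v : Fin n) → does (v F.≟ v) ≡ true
≟-refl v = dec-true (v F.≟ v) refl

≟-≢ : ∀ {n} {v w : Fin n} → v ≢ w → does (v F.≟ w) ≡ false
≟-≢ {v = v} {w} = dec-false (v F.≟ w)

≟-true⇒≡ : ∀ {n} {v w : Fin n} → does (v F.≟ w) ≡ true → v ≡ w
≟-true⇒≡ {v = v} {w} eq with v F.≟ w
... | yes v≡w = v≡w

≟-false⇒≢ : ∀ {n} {v w : Fin n} → does (v F.≟ w) ≡ false → v ≢ w
≟-false⇒≢ {v = v} eq refl with trans (sym (≟-refl v)) eq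
... | ()

⌊⌋-sound : ∀ {A : Set} (a? : Dec A) → ⌊ a? ⌋ ≡ true → A
⌊⌋-sound (yes a) _ = a

∧≡true : ∀ a {b} → a ∧ b ≡ true → a ≡ true × b ≡ true
∧≡true true eq = refl , eq

true-or-false : ∀ b → b ≡ true ⊎ b ≡ false
true-or-false true  = inj₁ refl
true-or-false false = inj₂ refl

∨≡false : ∀ a {b} → a ∨ b ≡ false → a ≡ false × b ≡ false
∨≡false false eq = refl , eq

Adj⇒≢ : ∀ {n} (G : Graph n) {v w} → Adj G v w → v ≢ w
Adj⇒≢ G {v} v~w refl with trans (sym v~w) (adj-irr G v)
... | ()

Adj-sym : ∀ {n} (G : Graph n) {v w} → Adj G v w → Adj G w v
Adj-sym G {v} {w} v~w = trans (adj-sym G w v) v~w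

neighboursIn : ∀ {n} → Graph n → (Fin n → Bool) → Fin n → ℕ
neighboursIn G U v = sum λ w → χ (adj G v w ∧ U w)

deg≡neighboursIn : ∀ {n} (G : Graph n) v → deg G v ≡ neighboursIn G (λ _ → true) v
deg≡neighboursIn G v = trans (sum-tabulate (λ w → χ (adj G v w))) (sum-cong-≗ λ w → cong χ (sym (∧-identityʳ (adj G v w))))

outdeg : ∀ {n} → Graph n → (Fin n → ℕ) → Fin n → ℕ
outdeg G rank v = neighboursIn G (λ w → ⌊ rank v <? rank w ⌋) v

record Schedule {n} (G : Graph n) (c : Config n) : Set where
  field
    rank           : Fin n → ℕ
    rank-injective : Injective _≡_ _≡_ rank
    supported      : ∀ v → outdeg G rank v ≤ lookup c v

lookup-fire-self : ∀ {n} (G : Graph n) u c → lookup (fire G u c) u ≡ lookup c u ∸ deg G u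
lookup-fire-self G u c = trans (lookup∘tabulate _ u)
  (cong (λ b → if b then lookup c u ∸ deg G u else (if adj G u u then suc (lookup c u) else lookup c u))
        (trans (isYes≗does (u F.≟ u)) (≟-refl u)))

lookup-fire-other : ∀ {n} (G : Graph n) u c {v} → v ≢ u → lookup (fire G u c) v ≡ χ (adj G u v) + lookup c v
lookup-fire-other G u c {v} v≢u = trans (lookup∘tabulate _ v)
  (trans (cong (λ b → if b then lookup c u ∸ deg G u else (if adj G u v then suc (lookup c v) else lookup c v))
               (trans (isYes≗does (v F.≟ u)) (≟-≢ v≢u)))
         (bump (adj G u v)))
  where
  bump : ∀ b → (if b then suc (lookup c v) else lookup c v) ≡ χ b + lookup c v
  bump true  = refl
  bump false = refl

module _ {n : ℕ} (G : Graph n) where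

  neighboursIn-mono : ∀ {U V v} → (∀ w → Adj G v w → U w ≡ true → V w ≡ true) → neighboursIn G U v ≤ neighboursIn G V v
  neighboursIn-mono {U} {V} {v} U⊆V = sum-mono-≤ pointwise
    where
    pointwise : ∀ w → χ (adj G v w ∧ U w) ≤ χ (adj G v w ∧ V w)
    pointwise w with adj G v w in v~w | U w in Uw
    ... | false | _     = z≤n
    ... | true  | false = z≤n
    ... | true  | true  rewrite U⊆V w v~w Uw = ≤-refl

  neighboursIn-∪ : ∀ {U V W v} → (∀ w → Adj G v w → U w ≡ true → V w ≡ true ⊎ W w ≡ true) →
             neighboursIn G U v ≤ neighboursIn G V v + neighboursIn G W v
  neighboursIn-∪ {U} {V} {W} {v} U⊆V∪W =
    ≤-trans (sum-mono-≤ pointwise) (≤-reflexive (ℕ∑.∑-distrib-+ (λ w → χ (adj G v w ∧ V w)) (λ w → χ (adj G v w ∧ W w))))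
    where
    pointwise : ∀ w → χ (adj G v w ∧ U w) ≤ χ (adj G v w ∧ V w) + χ (adj G v w ∧ W w)
    pointwise w with adj G v w in v~w | U w in Uw
    ... | false | _     = z≤n
    ... | true  | false = z≤n
    ... | true  | true  with U⊆V∪W w v~w Uw
    ...   | inj₁ Vw rewrite Vw = s≤s z≤n
    ...   | inj₂ Ww rewrite Ww = m≤n+m 1 _

  neighboursIn-single : ∀ u v → neighboursIn G (λ w → does (w F.≟ u)) v ≡ χ (adj G v u)
  neighboursIn-single u v = trans (sum-cong-≗ pointwise) (sum-pick u (χ ∘ adj G v))
    where
    pointwise : ∀ w → χ (adj G v w ∧ does (w F.≟ u)) ≡ (if does (w F.≟ u) then χ (adj G v w) else 0)
    pointwise w with does (w F.≟ u)
    ... | true  = cong χ (∧-identityʳ _)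
    ... | false = cong χ (∧-zeroʳ _)

module Replay {n : ℕ} (G : Graph n) {c : Config n} (S : Schedule G c) where
  open Schedule S

  -- The configuration reached from c once every vertex of U has fired exactly once.
  afterFiring : (Fin n → Bool) → Config n
  afterFiring U = tabulate λ v → lookup c v + neighboursIn G U v ∸ (if U v then deg G v else 0)

  afterFiring-cong : ∀ {U U′} → (∀ w → U w ≡ U′ w) → afterFiring U ≡ afterFiring U′
  afterFiring-cong U≗U′ = tabulate-cong λ v →
    cong₂ (λ m b → lookup c v + m ∸ (if b then deg G v else 0)) (sum-cong-≗ λ w → cong (χ ∘ (adj G v w ∧_)) (U≗U′ w)) (U≗U′ v)

  afterFiring-none : afterFiring (λ _ → false) ≡ c
  afterFiring-none = trans (tabulate-cong λ v → trans (cong (λ m → lookup c v + m) (nothing v)) (+-identityʳ _)) (tabulate∘lookup c)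
    where
    nothing : ∀ v → neighboursIn G (λ _ → false) v ≡ 0
    nothing v = trans (sum-cong-≗ λ w → cong χ (∧-zeroʳ (adj G v w))) (ℕ∑.sum-replicate-zero n)

  afterFiring-all : afterFiring (λ _ → true) ≡ c
  afterFiring-all = trans (tabulate-cong λ v → trans (cong (λ m → lookup c v + m ∸ deg G v) (sym (deg≡neighboursIn G v)))
                                                     (m+n∸n≡m (lookup c v) (deg G v)))
                          (tabulate∘lookup c)

  firedBefore : ℕ → Fin n → Bool
  firedBefore t w = ⌊ rank w <? t ⌋

  stateAt : ℕ → Config n
  stateAt t = afterFiring (firedBefore t)

  rank-≢ : ∀ {v w} → Adj G v w → rank v ≢ rank w
  rank-≢ {v} v~w = Adj⇒≢ G v~w ∘ rank-injective

  deg-bound : ∀ t v → rank v ≤ t → deg G v ≤ lookup c v + neighboursIn G (firedBefore t) v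
  deg-bound t v rank≤t = begin
    deg G v                                             ≡⟨ deg≡neighboursIn G v ⟩
    neighboursIn G (λ _ → true) v                       ≤⟨ neighboursIn-∪ G earlierOrLater ⟩
    neighboursIn G (firedBefore t) v + outdeg G rank v  ≤⟨ +-monoʳ-≤ _ (supported v) ⟩
    neighboursIn G (firedBefore t) v + lookup c v       ≡⟨ +-comm _ (lookup c v) ⟩
    lookup c v + neighboursIn G (firedBefore t) v       ∎
    where
    open ≤-Reasoning
    earlierOrLater : ∀ w → Adj G v w → true ≡ true → firedBefore t w ≡ true ⊎ ⌊ rank v <? rank w ⌋ ≡ true
    earlierOrLater w v~w _ with rank w <? t
    ... | yes _  = inj₁ refl
    ... | no w≮t = inj₂ (⌊⌋-yes (rank v <? rank w) (≤∧≢⇒< (≤-trans rank≤t (≮⇒≥ w≮t)) (rank-≢ v~w)))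

  debit-bound : ∀ t v → (if firedBefore t v then deg G v else 0) ≤ lookup c v + neighboursIn G (firedBefore t) v
  debit-bound t v with rank v <? t
  ... | yes v<t = deg-bound t v (<⇒≤ v<t)
  ... | no _    = z≤n

  firedBefore-other : ∀ {t w} → rank w ≢ t → firedBefore (suc t) w ≡ firedBefore t w
  firedBefore-other {t} {w} w≢t with rank w <? suc t | rank w <? t
  ... | yes w<1+t | no w≮t = ⊥-elim (w≢t (≤-antisym (≤-pred w<1+t) (≮⇒≥ w≮t)))
  ... | no w≮1+t  | yes w<t = ⊥-elim (w≮1+t (m<n⇒m<1+n w<t))
  ... | yes _ | yes _ = refl
  ... | no _  | no _  = refl

  firedBefore-self : ∀ {t u} → rank u ≡ t → firedBefore t u ≡ false × firedBefore (suc t) u ≡ true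
  firedBefore-self {t} {u} refl = ⌊⌋-no (rank u <? t) (<-irrefl refl) , ⌊⌋-yes (rank u <? suc t) ≤-refl

  neighboursIn-next : ∀ {t u} v → rank u ≡ t → neighboursIn G (firedBefore (suc t)) v ≡ neighboursIn G (firedBefore t) v + χ (adj G v u)
  neighboursIn-next {t} {u} v u≡t = begin
    neighboursIn G (firedBefore (suc t)) v                                        ≡⟨ sum-cong-≗ pointwise ⟩
    sum (λ w → χ (adj G v w ∧ firedBefore t w) + χ (adj G v w ∧ does (w F.≟ u)))  ≡⟨ ℕ∑.∑-distrib-+ {n} _ _ ⟩
    neighboursIn G (firedBefore t) v + neighboursIn G (λ w → does (w F.≟ u)) v    ≡⟨ cong (_ +_) (neighboursIn-single G u v) ⟩
    neighboursIn G (firedBefore t) v + χ (adj G v u)                              ∎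
    where
    open ≡-Reasoning
    pointwise : ∀ w → χ (adj G v w ∧ firedBefore (suc t) w) ≡ χ (adj G v w ∧ firedBefore t w) + χ (adj G v w ∧ does (w F.≟ u))
    pointwise w with w F.≟ u
    ... | yes refl rewrite firedBefore-self u≡t .proj₁ | firedBefore-self u≡t .proj₂ | ∧-zeroʳ (adj G v w) = refl
    ... | no w≢u   rewrite firedBefore-other {t} {w} (λ w≡t → w≢u (rank-injective (trans w≡t (sym u≡t))))
                          | ∧-zeroʳ (adj G v w) = sym (+-identityʳ _)

  lookup-stateAt : ∀ t v → lookup (stateAt t) v ≡ lookup c v + neighboursIn G (firedBefore t) v ∸ (if firedBefore t v then deg G v else 0)
  lookup-stateAt t v = lookup∘tabulate _ v

  legal-next : ∀ {t u} → rank u ≡ t → Legal G u (stateAt t)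
  legal-next {t} {u} u≡t rewrite lookup-stateAt t u | firedBefore-self u≡t .proj₁ =
    deg-bound t u (≤-reflexive u≡t)

  fire-next : ∀ {t u} → rank u ≡ t → fire G u (stateAt t) ≡ stateAt (suc t)
  fire-next {t} {u} u≡t = Pointwise-≡⇒≡ (ext pointwise)
    where
    pointwise : ∀ v → lookup (fire G u (stateAt t)) v ≡ lookup (stateAt (suc t)) v
    pointwise v with v F.≟ u
    ... | yes refl rewrite lookup-fire-self G v (stateAt t) | lookup-stateAt t v | lookup-stateAt (suc t) v
                         | neighboursIn-next v u≡t | adj-irr G v | firedBefore-self u≡t .proj₁ | firedBefore-self u≡t .proj₂
                         | +-identityʳ (neighboursIn G (firedBefore t) v) = refl
    ... | no v≢u rewrite lookup-fire-other G u (stateAt t) v≢u | lookup-stateAt t v | lookup-stateAt (suc t) v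
                       | neighboursIn-next v u≡t | firedBefore-other {t} {v} (λ v≡t → v≢u (rank-injective (trans v≡t (sym u≡t))))
                       | adj-sym G u v =
      trans (sym (+-∸-assoc (χ (adj G v u)) (debit-bound t v)))
            (cong (_∸ (if firedBefore t v then deg G v else 0)) (shuffle (χ (adj G v u)) (lookup c v) (neighboursIn G (firedBefore t) v)))
      where
      shuffle : ∀ a b m → a + (b + m) ≡ b + (m + a)
      shuffle = solve-∀

  idle : ∀ {t} → (∀ u → rank u ≢ t) → stateAt (suc t) ≡ stateAt t
  idle unranked = afterFiring-cong λ w → firedBefore-other (unranked w)

  firingsFrom : ℕ → ℕ → List (Fin n)
  firingsFrom t zero = []
  firingsFrom t (suc d) with any? (λ u → rank u ≟ t)
  ... | yes (u , _) = u ∷ firingsFrom (suc t) d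
  ... | no _        = firingsFrom (suc t) d

  stateAt-start : stateAt 0 ≡ c
  stateAt-start = trans (afterFiring-cong λ w → ⌊⌋-no (rank w <? 0) λ ()) afterFiring-none

  stateAt-end : ∀ t → (∀ v → rank v < t) → stateAt t ≡ c
  stateAt-end t late = trans (afterFiring-cong λ w → ⌊⌋-yes (rank w <? t) (late w)) afterFiring-all

  replay : ∀ t d → LegalSeq G (stateAt t) (firingsFrom t d) (stateAt (t + d))
  replay t zero    rewrite +-identityʳ t = done
  replay t (suc d) with any? (λ u → rank u ≟ t) | replay (suc t) d
  ... | yes (u , u≡t) | rest rewrite +-suc t d =
    legal-next u≡t ∷ subst (λ x → LegalSeq G x (firingsFrom (suc t) d) (stateAt (suc t + d))) (sym (fire-next u≡t)) rest
  ... | no unranked   | rest rewrite +-suc t d =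
    subst (λ x → LegalSeq G x (firingsFrom (suc t) d) (stateAt (suc t + d))) (idle λ u u≡t → unranked (u , u≡t)) rest

  firingsFrom-nonempty : ∀ t d v → t ≤ rank v → rank v < t + d → ∃[ u ] ∃[ σ ] firingsFrom t d ≡ u ∷ σ
  firingsFrom-nonempty t zero    v t≤v v<t = ⊥-elim (≤⇒≯ t≤v (subst (rank v <_) (+-identityʳ t) v<t))
  firingsFrom-nonempty t (suc d) v t≤v v<t+d with any? (λ u → rank u ≟ t)
  ... | yes (u , _) = u , firingsFrom (suc t) d , refl
  ... | no unranked = firingsFrom-nonempty (suc t) d v (≤∧≢⇒< t≤v λ t≡v → unranked (v , sym t≡v)) (subst (rank v <_) (+-suc t d) v<t+d)

schedule⇒selfReachable : ∀ {n} (G : Graph n) {c} → Fin n → Schedule G c → SelfReachable G c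
schedule⇒selfReachable G {c} v₀ S =
  let u , σ , firings≡ = firingsFrom-nonempty 0 horizon v₀ z≤n (late v₀)
  in  u , σ , subst₂ (LegalSeq G c) firings≡ (stateAt-end horizon late) fromStart
  where
  open Schedule S
  open Replay G S
  horizon : ℕ
  horizon = suc (sum rank)
  late : ∀ v → rank v < horizon
  late v = s≤s (≤-sum rank v)
  fromStart : LegalSeq G c (firingsFrom 0 horizon) (stateAt horizon)
  fromStart = subst (λ c′ → LegalSeq G c′ (firingsFrom 0 horizon) (stateAt horizon)) stateAt-start (replay 0 horizon)

occurs : ∀ {n} → List (Fin n) → Fin n → Bool
occurs []      v = false
occurs (u ∷ s) v = does (v F.≟ u) ∨ occurs s v

lastFiring : ∀ {n} → List (Fin n) → Fin n → ℕ
lastFiring []      v = 0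
lastFiring (u ∷ s) v = if occurs s v then suc (lastFiring s v) else 0

-- Order of last firing; the index term only separates vertices whose last firing is at position 0.
firingRank : ∀ {n} → List (Fin n) → Fin n → ℕ
firingRank {n} s v = lastFiring s v * n + toℕ v

firingRank-injective : ∀ {n} (s : List (Fin n)) → Injective _≡_ _≡_ (firingRank s)
firingRank-injective {suc n} s {v} {w} eq = toℕ-injective (trans (sym (residue v)) (trans (cong (_% suc n) eq) (residue w)))
  where
  residue : ∀ x → firingRank s x % suc n ≡ toℕ x
  residue x = trans (cong (_% suc n) (+-comm (lastFiring s x * suc n) (toℕ x)))
                    (trans ([m+kn]%n≡m%n (toℕ x) (lastFiring s x) (suc n)) (m<n⇒m%n≡m (toℕ<n x)))

occurs-head : ∀ {n} (u : Fin n) s v → occurs (u ∷ s) v ≡ true → occurs s v ≡ false → v ≡ u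
occurs-head u s v v∈u∷s v∉s with v F.≟ u
... | yes v≡u = v≡u
... | no _    = ⊥-elim (case trans (sym v∈u∷s) v∉s of λ ())

firingRank-later : ∀ {n} (u : Fin n) s v → occurs s v ≡ true → firingRank (u ∷ s) v ≡ n + firingRank s v
firingRank-later {n} u s v v∈s rewrite v∈s = +-assoc n (lastFiring s v * n) (toℕ v)

firingRank-last : ∀ {n} (u : Fin n) s v → occurs s v ≡ false → firingRank (u ∷ s) v ≡ toℕ v
firingRank-last u s v v∉s rewrite v∉s = refl

module _ {n : ℕ} (G : Graph n) where

  unfired-gains : ∀ {c s c′} → LegalSeq G c s c′ → ∀ v → occurs s v ≡ false →
                  lookup c v + neighboursIn G (occurs s) v ≤ lookup c′ v
  unfired-gains {c} done v _ = ≤-reflexive (trans (cong (lookup c v +_) none) (+-identityʳ _))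
    where
    none : neighboursIn G (occurs []) v ≡ 0
    none = trans (sum-cong-≗ λ w → cong χ (∧-zeroʳ (adj G v w))) (ℕ∑.sum-replicate-zero n)
  unfired-gains {c} {u ∷ s} {c′} (_ ∷ rest) v v∉u∷s = begin
    lookup c v + neighboursIn G (occurs (u ∷ s)) v                        ≤⟨ +-monoʳ-≤ _ (neighboursIn-∪ G headOrTail) ⟩
    lookup c v + (neighboursIn G (λ w → does (w F.≟ u)) v + neighboursIn G (occurs s) v)
                                                                    ≡⟨ cong (λ m → lookup c v + (m + _)) (neighboursIn-single G u v) ⟩
    lookup c v + (χ (adj G v u) + neighboursIn G (occurs s) v)  ≡⟨ shuffle (lookup c v) (χ (adj G v u)) _ ⟩
    (χ (adj G v u) + lookup c v) + neighboursIn G (occurs s) v  ≡⟨ cong (_+ _) fired ⟨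
    lookup (fire G u c) v + neighboursIn G (occurs s) v         ≤⟨ unfired-gains rest v v∉s ⟩
    lookup c′ v                                                 ∎
    where
    open ≤-Reasoning
    v≢u = ≟-false⇒≢ (∨≡false (does (v F.≟ u)) v∉u∷s .proj₁)
    v∉s = ∨≡false (does (v F.≟ u)) v∉u∷s .proj₂
    fired : lookup (fire G u c) v ≡ χ (adj G v u) + lookup c v
    fired = trans (lookup-fire-other G u c v≢u) (cong (λ b → χ b + lookup c v) (adj-sym G u v))
    shuffle : ∀ a b m → a + (b + m) ≡ (b + a) + m
    shuffle = solve-∀
    headOrTail : ∀ w → Adj G v w → occurs (u ∷ s) w ≡ true → does (w F.≟ u) ≡ true ⊎ occurs s w ≡ true
    headOrTail w _ w∈u∷s with does (w F.≟ u)
    ... | true  = inj₁ refl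
    ... | false = inj₂ w∈u∷s

  firesAfter : List (Fin n) → Fin n → Fin n → Bool
  firesAfter s v w = occurs s w ∧ ⌊ firingRank s v <? firingRank s w ⌋

  firesAfter⇒< : ∀ {s v w} → firesAfter s v w ≡ true → firingRank s v < firingRank s w
  firesAfter⇒< after = ⌊⌋-sound (_ <? _) (∧≡true _ after .proj₂)

  -- After its last firing v holds no debt, and every neighbour firing later sends it a chip.
  fired-keeps : ∀ {c s c′} → LegalSeq G c s c′ → ∀ v → occurs s v ≡ true →
                neighboursIn G (firesAfter s v) v ≤ lookup c′ v
  fired-keeps {s = u ∷ s} (_ ∷ rest) v v∈u∷s with true-or-false (occurs s v)
  ... | inj₁ v∈s = ≤-trans (neighboursIn-mono G (λ w _ after → stillAfter w (firesAfter⇒< {u ∷ s} {v} {w} after))) (fired-keeps rest v v∈s)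
    where
    stillAfter : ∀ w → firingRank (u ∷ s) v < firingRank (u ∷ s) w → firesAfter s v w ≡ true
    stillAfter w v<w with true-or-false (occurs s w)
    ... | inj₁ w∈s = subst (λ b → b ∧ ⌊ firingRank s v <? firingRank s w ⌋ ≡ true) (sym w∈s) (⌊⌋-yes (_ <? _) (+-cancelˡ-< n _ _
                       (subst₂ _<_ (firingRank-later u s v v∈s) (firingRank-later u s w w∈s) v<w)))
    ... | inj₂ w∉s = ⊥-elim (<-asym v<w (begin-strict
        firingRank (u ∷ s) w  ≡⟨ firingRank-last u s w w∉s ⟩
        toℕ w                 <⟨ toℕ<n w ⟩
        n                     ≤⟨ m≤m+n n _ ⟩
        n + firingRank s v    ≡⟨ firingRank-later u s v v∈s ⟨
        firingRank (u ∷ s) v  ∎))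
      where open ≤-Reasoning
  ... | inj₂ v∉s = ≤-trans (neighboursIn-mono G (λ w _ after → inTail w (∧≡true _ after .proj₁) (firesAfter⇒< {u ∷ s} {v} {w} after)))
                        (≤-trans (m≤n+m _ _) (unfired-gains rest v v∉s))
    where
    inTail : ∀ w → occurs (u ∷ s) w ≡ true → firingRank (u ∷ s) v < firingRank (u ∷ s) w → occurs s w ≡ true
    inTail w w∈u∷s v<w with true-or-false (occurs s w)
    ... | inj₁ w∈s = w∈s
    ... | inj₂ w∉s = ⊥-elim (<-irrefl (cong toℕ (trans (occurs-head u s v v∈u∷s v∉s) (sym (occurs-head u s w w∈u∷s w∉s))))
                                      (subst₂ _<_ (firingRank-last u s v v∉s) (firingRank-last u s w w∉s) v<w))


  -- A vertex that never fires would strictly gain chips from a firing neighbour.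
  firing-spreads : ∀ {c s} → LegalSeq G c s c → ∀ {v w} → Adj G v w → occurs s v ≡ true → occurs s w ≡ true
  firing-spreads {c} {s} L {v} {w} v~w v∈s with true-or-false (occurs s w)
  ... | inj₁ w∈s = w∈s
  ... | inj₂ w∉s = ⊥-elim (<-irrefl refl (begin-strict
    lookup c w                                <⟨ m<m+n (lookup c w) (≤-trans (≤-reflexive (cong χ (sym v∈w))) (≤-sum _ v)) ⟩
    lookup c w + neighboursIn G (occurs s) w  ≤⟨ unfired-gains L w w∉s ⟩
    lookup c w                              ∎))
    where
    open ≤-Reasoning
    v∈w : adj G w v ∧ occurs s v ≡ true
    v∈w = cong₂ _∧_ (Adj-sym G v~w) v∈s

selfReachable⇒schedule : ∀ {n} (G : Graph n) {c} → Connected G → SelfReachable G c → Schedule G c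
selfReachable⇒schedule {n} G {c} connected (u , σ , L) = record
  { rank           = firingRank s
  ; rank-injective = firingRank-injective s
  ; supported      = λ v → ≤-trans (neighboursIn-mono G (λ w _ later → cong₂ _∧_ (everyoneFires w) later))
                                   (fired-keeps G L v (everyoneFires v))
  }
  where
  s = u ∷ σ
  reaches : ∀ {v w} → Walk G v w → occurs s v ≡ true → occurs s w ≡ true
  reaches here            v∈s = v∈s
  reaches (step v~x x⇝w) v∈s = reaches x⇝w (firing-spreads G L v~x v∈s)
  everyoneFires : ∀ v → occurs s v ≡ true
  everyoneFires v = reaches (connected u v) (cong (_∨ occurs σ u) (≟-refl u))

-- Rooted trees

data FromTo {A : Set} : A → A → List A → Set where
  stop : ∀ {a} → FromTo a a [ a ]
  go   : ∀ a {k b L} → FromTo k b L → FromTo a b (a ∷ L)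

record SimplePath {A : Set} (R : A → A → Set) (a b : A) : Set where
  constructor simplePath
  field
    vertices : List A
    fromTo   : FromTo a b vertices
    unique   : Unique vertices
    linked   : Linked R vertices

module _ {A : Set} (_≟_ : DecidableEquality A) {R : A → A → Set} where
  open DecMembership _≟_ using (_∈?_)

  suffixFrom : ∀ {a k b L} → a ∈ L → FromTo k b L → Unique L → Linked R L → SimplePath R a b
  suffixFrom (here refl) stop          unique linked = simplePath _ stop unique linked
  suffixFrom (here refl) (go _ path)   unique linked = simplePath _ (go _ path) unique linked
  suffixFrom (there a∈L) (go _ path) (_ ∷ unique) linked = suffixFrom a∈L path unique (Linked.tail linked)

  simplify : ∀ {a b} → Star R a b → SimplePath R a b
  simplify ε = simplePath _ stop ([] ∷ []) [-]
  simplify {a} {b} (_◅_ {j = k} aRk k⇝b) with simplify k⇝b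
  ... | simplePath L path unique linked with a ∈? L
  ...   | yes a∈L = suffixFrom a∈L path unique linked
  ...   | no  a∉L = simplePath (a ∷ L) (go a path) (¬Any⇒All¬ L a∉L ∷ unique) (extend path linked)
    where
    extend : ∀ {L} → FromTo k b L → Linked R L → Linked R (a ∷ L)
    extend stop     _      = aRk ∷ [-]
    extend (go _ _) linked = aRk ∷ linked

Linked-snoc : ∀ {A : Set} {R : A → A → Set} {x b a L} → FromTo x b L → Linked R L → R b a → Linked R (L ++ [ a ])
Linked-snoc stop              _             bRa = bRa ∷ [-]
Linked-snoc (go _ stop)       (xRy ∷ _)     bRa = xRy ∷ Linked-snoc stop [-] bRa
Linked-snoc (go _ (go _ path)) (xRy ∷ linked) bRa = xRy ∷ Linked-snoc (go _ path) linked bRa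

AdjExcept : ∀ {n} → Graph n → Fin n → Fin n → Fin n → Fin n → Set
AdjExcept G a b x y = Adj G x y × ¬ ((x ≡ a × y ≡ b) ⊎ (x ≡ b × y ≡ a))

acyclic⇒bridge : ∀ {n} (G : Graph n) → ¬ HasCycle G → ∀ {a b} → Adj G a b → ¬ Star (AdjExcept G a b) a b
acyclic⇒bridge G acyclic {a} {b} a~b a⇝b with simplify F._≟_ a⇝b
... | simplePath _ stop _ _                                = Adj⇒≢ G a~b refl
... | simplePath _ (go _ stop) _ ((_ , notAB) ∷ _)          = notAB (inj₁ (refl , refl))
... | simplePath _ (go _ (go _ stop)) unique linked        =
  acyclic (a , _ , _ , [] , unique , Linked-snoc (go _ (go _ stop)) (Linked.map proj₁ linked) (Adj-sym G a~b))
... | simplePath _ (go _ (go _ (go _ path))) unique linked =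
  acyclic (a , _ , _ , _ , unique , Linked-snoc (go _ (go _ (go _ path))) (Linked.map proj₁ linked) (Adj-sym G a~b))

least : ∀ {P : ℕ → Set} → (∀ d → Dec (P d)) → ∀ {d} → P d → ∃[ m ] P m × (∀ e → P e → m ≤ e)
least {P} P? {d} Pd = search 0 d (λ _ ()) Pd
  where
  search : ∀ i fuel → (∀ e → e < i → ¬ P e) → P (i + fuel) → ∃[ m ] P m × (∀ e → P e → m ≤ e)
  search i fuel earlier Pi+fuel with P? i
  ... | yes Pi = i , Pi , λ e Pe → ≮⇒≥ (λ e<i → earlier e e<i Pe)
  search i zero    earlier Pi+0    | no ¬Pi = ⊥-elim (¬Pi (subst P (+-identityʳ i) Pi+0))
  search i (suc f) earlier Pi+1+f | no ¬Pi = search (suc i) f earlier′ (subst P (+-suc i f) Pi+1+f)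
    where
    earlier′ : ∀ e → e < suc i → ¬ P e
    earlier′ e e<1+i with m≤n⇒m<n∨m≡n (≤-pred e<1+i)
    ... | inj₁ e<i  = earlier e e<i
    ... | inj₂ refl = ¬Pi

module Rooted {n : ℕ} (G : Graph n) (connected : Connected G) (r : Fin n) where

  Within : ℕ → Fin n → Set
  Within zero    v = v ≡ r
  Within (suc d) v = v ≡ r ⊎ ∃[ u ] Adj G v u × Within d u

  within? : ∀ d v → Dec (Within d v)
  within? zero    v = v F.≟ r
  within? (suc d) v = (v F.≟ r) ⊎-dec any? (λ u → (adj G v u ≟ᵇ true) ×-dec within? d u)

  walk⇒within : ∀ {v} → Walk G v r → ∃[ d ] Within d v
  walk⇒within here            = 0 , refl
  walk⇒within (step v~u u⇝r) = let d , near = walk⇒within u⇝r in suc d , inj₂ (_ , v~u , near)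

  -- Abstract, so that `with v F.≟ r` below does not also abstract the test hidden inside depth v.
  abstract
    depth : Fin n → ℕ
    depth v = least (λ d → within? d v) (walk⇒within (connected v r) .proj₂) .proj₁

    depth-within : ∀ v → Within (depth v) v
    depth-within v = least (λ d → within? d v) (walk⇒within (connected v r) .proj₂) .proj₂ .proj₁

    depth-minimal : ∀ {e} v → Within e v → depth v ≤ e
    depth-minimal v = least (λ d → within? d v) (walk⇒within (connected v r) .proj₂) .proj₂ .proj₂ _

  depth-root : depth r ≡ 0
  depth-root = n≤0⇒n≡0 (depth-minimal r refl)

  depth≡0 : ∀ {v} → depth v ≡ 0 → v ≡ r
  depth≡0 {v} d≡0 = subst (λ d → Within d v) d≡0 (depth-within v)

  towardsRoot : ∀ v → v ≢ r → ∃[ u ] Adj G v u × depth u < depth v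
  towardsRoot v v≢r with depth v | depth-within v
  ... | zero  | v≡r                  = ⊥-elim (v≢r v≡r)
  ... | suc d | inj₁ v≡r             = ⊥-elim (v≢r v≡r)
  ... | suc d | inj₂ (u , v~u , near) = u , v~u , s≤s (depth-minimal u near)

  parent : Fin n → Fin n
  parent v with v F.≟ r
  ... | yes _   = r
  ... | no v≢r = towardsRoot v v≢r .proj₁

  parent-root : parent r ≡ r
  parent-root with r F.≟ r
  ... | yes _   = refl
  ... | no r≢r = ⊥-elim (r≢r refl)

  parent-adj : ∀ {v} → v ≢ r → Adj G v (parent v)
  parent-adj {v} v≢r with v F.≟ r
  ... | yes v≡r  = ⊥-elim (v≢r v≡r)
  ... | no v≢r′ = towardsRoot v v≢r′ .proj₂ .proj₁

  parent-depth : ∀ {v} → v ≢ r → depth (parent v) < depth v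
  parent-depth {v} v≢r with v F.≟ r
  ... | yes v≡r  = ⊥-elim (v≢r v≡r)
  ... | no v≢r′ = towardsRoot v v≢r′ .proj₂ .proj₂

  parent-depth≤ : ∀ {f} v → depth v ≤ suc f → depth (parent v) ≤ f
  parent-depth≤ {f} v d≤1+f = byCases (v F.≟ r)
    where
    byCases : Dec (v ≡ r) → depth (parent v) ≤ f
    byCases (yes refl) = subst (_≤ f) (sym (trans (cong depth parent-root) depth-root)) z≤n
    byCases (no v≢r)   = ≤-pred (≤-trans (parent-depth v≢r) d≤1+f)

  ancestorWithin : Fin n → ℕ → Fin n → Bool
  ancestorWithin j zero    x = does (x F.≟ j)
  ancestorWithin j (suc f) x = does (x F.≟ j) ∨ ancestorWithin j f (parent x)

  ancestorWithin-root : ∀ j f → ancestorWithin j f r ≡ does (r F.≟ j)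
  ancestorWithin-root j zero    = refl
  ancestorWithin-root j (suc f) rewrite parent-root | ancestorWithin-root j f = ∨-idem _

  ancestorWithin-stable : ∀ j f g x → depth x ≤ f → depth x ≤ g → ancestorWithin j f x ≡ ancestorWithin j g x
  ancestorWithin-stable j zero g x x≤0 _ rewrite depth≡0 (n≤0⇒n≡0 x≤0) = sym (ancestorWithin-root j g)
  ancestorWithin-stable j (suc f) zero x x≤1+f x≤0 = sym (ancestorWithin-stable j zero (suc f) x x≤0 x≤1+f)
  ancestorWithin-stable j (suc f) (suc g) x x≤f x≤g =
    cong (does (x F.≟ j) ∨_) (ancestorWithin-stable j f g (parent x) (parent-depth≤ x x≤f) (parent-depth≤ x x≤g))

  inSubtree : Fin n → Fin n → Bool
  inSubtree j x = ancestorWithin j (depth x) x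

  inSubtree-step : ∀ j x → inSubtree j x ≡ does (x F.≟ j) ∨ inSubtree j (parent x)
  inSubtree-step j x = trans (ancestorWithin-stable j (depth x) (suc (depth x)) x ≤-refl (n≤1+n _))
    (cong (does (x F.≟ j) ∨_) (ancestorWithin-stable j (depth x) (depth (parent x)) (parent x) (parent-depth≤ x (n≤1+n _)) ≤-refl))

  inSubtree-self : ∀ j → inSubtree j j ≡ true
  inSubtree-self j = trans (inSubtree-step j j) (cong (_∨ inSubtree j (parent j)) (≟-refl j))

  inSubtree-root : ∀ {j} → j ≢ r → inSubtree j r ≡ false
  inSubtree-root j≢r = trans (cong (λ d → ancestorWithin _ d r) depth-root) (≟-≢ (j≢r ∘ sym))

  module _ (acyclic : ¬ HasCycle G) where

    private
      climb : ∀ {u w} → parent u ≢ w → parent w ≢ u → ∀ fuel v → depth v < fuel → Star (AdjExcept G u w) v r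
      climb pu≢w pw≢u (suc fuel) v v<fuel with v F.≟ r
      ... | yes refl = ε
      ... | no v≢r   = (parent-adj v≢r , notEdge) ◅ climb pu≢w pw≢u fuel (parent v) (≤-trans (parent-depth v≢r) (≤-pred v<fuel))
        where
        notEdge : ¬ ((v ≡ _ × parent v ≡ _) ⊎ (v ≡ _ × parent v ≡ _))
        notEdge (inj₁ (refl , pv≡w)) = pu≢w pv≡w
        notEdge (inj₂ (refl , pv≡u)) = pw≢u pv≡u

      AdjExcept-sym : ∀ {u w x y} → AdjExcept G u w x y → AdjExcept G u w y x
      AdjExcept-sym (x~y , notEdge) = Adj-sym G x~y , λ
        { (inj₁ (y≡u , x≡w)) → notEdge (inj₂ (x≡w , y≡u))
        ; (inj₂ (y≡w , x≡u)) → notEdge (inj₁ (x≡u , y≡w)) }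

    -- Otherwise the two climbs to the root avoid the edge uw, which is impossible in a tree.
    parent-edge : ∀ {u w} → Adj G u w → parent u ≡ w ⊎ parent w ≡ u
    parent-edge {u} {w} u~w with parent u F.≟ w | parent w F.≟ u
    ... | yes pu≡w | _        = inj₁ pu≡w
    ... | no _     | yes pw≡u = inj₂ pw≡u
    ... | no pu≢w  | no pw≢u  = ⊥-elim (acyclic⇒bridge G acyclic u~w
          (climb pu≢w pw≢u _ u ≤-refl ◅◅ Star.reverse AdjExcept-sym (climb pu≢w pw≢u _ w ≤-refl)))

    parent-of-root-neighbour : ∀ {j} → Adj G j r → parent j ≡ r
    parent-of-root-neighbour j~r with parent-edge j~r
    ... | inj₁ pj≡r = pj≡r
    ... | inj₂ pr≡j = ⊥-elim (Adj⇒≢ G j~r (trans (sym pr≡j) parent-root))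

    leaving-subtree : ∀ {j} → Adj G j r → ∀ {u w} → Adj G u w → inSubtree j u ≡ true → inSubtree j w ≡ false → u ≡ j × w ≡ r
    leaving-subtree {j} j~r {u} {w} u~w u∈ w∉ with parent-edge u~w
    ... | inj₁ pu≡w = u≡j , trans (sym pu≡w) (trans (cong parent u≡j) (parent-of-root-neighbour j~r))
      where
      u≡j : u ≡ j
      u≡j = ≟-true⇒≡ (trans (sym (∨-identityʳ _)) (trans (cong (does (u F.≟ j) ∨_) (sym (trans (cong (inSubtree j) pu≡w) w∉)))
                          (trans (sym (inSubtree-step j u)) u∈)))
    ... | inj₂ pw≡u = ⊥-elim (case trans (sym w∉) w∈ of λ ())
      where
      w∈ : inSubtree j w ≡ true
      w∈ = trans (inSubtree-step j w)
             (trans (cong (λ x → does (w F.≟ j) ∨ inSubtree j x) pw≡u) (trans (cong (does (w F.≟ j) ∨_) u∈) (∨-zeroʳ _)))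

    module _ {rank : Fin n → ℕ} (rank-injective : Injective _≡_ _≡_ rank) where

      private
        parentArc : Fin n → Fin n → Bool
        parentArc v w = does (w F.≟ parent v) ∧ not (does (v F.≟ r))

        Precedes : Fin n → Fin n → Bool
        Precedes v w = ⌊ rank v <? rank w ⌋

        parentArc-parent : ∀ {v w} → parent v ≡ w → v ≢ r → parentArc v w ≡ true
        parentArc-parent {v} {w} pv≡w v≢r rewrite dec-true (w F.≟ parent v) (sym pv≡w) | ≟-≢ v≢r = refl

        parentArc-adj : ∀ {v w} → parentArc v w ≡ true → Adj G v w
        parentArc-adj {v} {w} arc with ∧≡true (does (w F.≟ parent v)) arc
        ... | w≡pv , v≢r = subst (Adj G v) (sym (≟-true⇒≡ w≡pv)) (parent-adj (≟-false⇒≢ (trans (sym (not-involutive _)) (cong not v≢r))))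

        arc≤parentArcs : ∀ v w → χ (adj G v w ∧ Precedes v w) ≤ χ (parentArc v w ∧ Precedes v w) + χ (parentArc w v ∧ Precedes v w)
        arc≤parentArcs v w with adj G v w in v~w
        ... | false = z≤n
        ... | true with parent-edge v~w
        ...   | inj₁ pv≡w = ≤-trans (≤-reflexive (cong (λ b → χ (b ∧ Precedes v w)) (sym arc))) (m≤m+n _ _)
          where arc = parentArc-parent {v} {w} pv≡w λ { refl → Adj⇒≢ G v~w (trans (sym parent-root) pv≡w) }
        ...   | inj₂ pw≡v = ≤-trans (≤-reflexive (cong (λ b → χ (b ∧ Precedes v w)) (sym arc))) (m≤n+m _ _)
          where arc = parentArc-parent {w} {v} pw≡v λ { refl → Adj⇒≢ G v~w (sym (trans (sym parent-root) pw≡v)) }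

        parentArc-oriented : ∀ v w → χ (parentArc v w ∧ Precedes v w) + χ (parentArc v w ∧ Precedes w v) ≡ χ (parentArc v w)
        parentArc-oriented v w with parentArc v w in arc
        ... | false = refl
        ... | true with <-cmp (rank v) (rank w)
        ...   | tri< v<w _ w≮v rewrite ⌊⌋-yes (rank v <? rank w) v<w | ⌊⌋-no (rank w <? rank v) w≮v = refl
        ...   | tri> v≮w _ w<v rewrite ⌊⌋-no (rank v <? rank w) v≮w | ⌊⌋-yes (rank w <? rank v) w<v = refl
        ...   | tri≈ _ v≡w _ = ⊥-elim (Adj⇒≢ G (parentArc-adj arc) (rank-injective v≡w))

        parentArcs-from : ∀ v → sum (λ w → χ (parentArc v w)) ≡ χ (not (does (v F.≟ r)))
        parentArcs-from v = trans (sum-cong-≗ pointwise) (sum-pick (parent v) (λ _ → χ (not (does (v F.≟ r)))))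
          where
          pointwise : ∀ w → χ (parentArc v w) ≡ (if does (w F.≟ parent v) then χ (not (does (v F.≟ r))) else 0)
          pointwise w with does (w F.≟ parent v)
          ... | true  = refl
          ... | false = refl

        nonRoots : sum (λ v → χ (not (does (v F.≟ r)))) + 1 ≡ n
        nonRoots = trans (sum-agreeing-off r λ v v≢r → cong (χ ∘ not) (≟-≢ v≢r))
                         (trans (cong₂ _+_ (sum-ones n) (cong (χ ∘ not) (≟-refl r))) (+-identityʳ n))

      -- Every edge of the tree is an arc of exactly one vertex, so there are n - 1 arcs.
      sum-outdeg< : sum (outdeg G rank) < n
      sum-outdeg< = begin-strict
        sum (outdeg G rank)                                                        ≤⟨ sum-mono-≤ (λ v → sum-mono-≤ (arc≤parentArcs v)) ⟩
        sum (λ v → sum λ w → χ (parentArc v w ∧ Precedes v w) + χ (parentArc w v ∧ Precedes v w))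
                                                                                   ≡⟨ sum-transpose-right (λ v w → χ (parentArc v w ∧ Precedes v w)) (λ v w → χ (parentArc v w ∧ Precedes w v)) ⟩
        sum (λ v → sum λ w → χ (parentArc v w ∧ Precedes v w) + χ (parentArc v w ∧ Precedes w v))
                                                                                   ≡⟨ sum-cong-≗ (λ v → sum-cong-≗ (parentArc-oriented v)) ⟩
        sum (λ v → sum λ w → χ (parentArc v w))     ≡⟨ sum-cong-≗ parentArcs-from ⟩
        sum (λ v → χ (not (does (v F.≟ r))))        <⟨ n<1+n _ ⟩
        suc (sum (λ v → χ (not (does (v F.≟ r)))))  ≡⟨ +-comm 1 _ ⟩
        sum (λ v → χ (not (does (v F.≟ r)))) + 1    ≡⟨ nonRoots ⟩
        n                                           ∎
        where open ≤-Reasoning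

-- Moving chips

plusE : ∀ {n} → Config n → Fin n → Config n
plusE c j = updateAt c j suc

module _ {n : ℕ} (c : Config n) where

  lookup-minusE-self : ∀ i → lookup (minusE c i) i ≡ lookup c i ∸ 1
  lookup-minusE-self i = lookup∘updateAt i c

  lookup-minusE-other : ∀ {v} i → v ≢ i → lookup (minusE c i) v ≡ lookup c v
  lookup-minusE-other {v} i v≢i = lookup∘updateAt′ v i v≢i c

  lookup-plusE-self : ∀ j → lookup (plusE c j) j ≡ suc (lookup c j)
  lookup-plusE-self j = lookup∘updateAt j c

  lookup-plusE-other : ∀ {v} j → v ≢ j → lookup (plusE c j) v ≡ lookup c v
  lookup-plusE-other {v} j v≢j = lookup∘updateAt′ v j v≢j c

  minusE-≤ : ∀ i v → lookup (minusE c i) v ≤ lookup c v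
  minusE-≤ i v with v F.≟ i
  ... | yes refl = ≤-trans (≤-reflexive (lookup-minusE-self v)) (m∸n≤m _ 1)
  ... | no v≢i   = ≤-reflexive (lookup-minusE-other i v≢i)

  plusE-≥ : ∀ j v → lookup c v ≤ lookup (plusE c j) v
  plusE-≥ j v with v F.≟ j
  ... | yes refl = ≤-trans (n≤1+n _) (≤-reflexive (sym (lookup-plusE-self v)))
  ... | no v≢j   = ≤-reflexive (sym (lookup-plusE-other j v≢j))

  chips-updateAt : ∀ i (f : ℕ → ℕ) → chips (updateAt c i f) + lookup c i ≡ chips c + f (lookup c i)
  chips-updateAt i f = begin
    chips (updateAt c i f) + lookup c i         ≡⟨ cong (_+ lookup c i) (chips≡sum (updateAt c i f)) ⟩
    sum (lookup (updateAt c i f)) + lookup c i  ≡⟨ sum-agreeing-off i (λ v v≢i → lookup∘updateAt′ v i v≢i c) ⟩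
    sum (lookup c) + lookup (updateAt c i f) i  ≡⟨ cong₂ _+_ (sym (chips≡sum c)) (lookup∘updateAt i c) ⟩
    chips c + f (lookup c i)                    ∎
    where open ≡-Reasoning

  chips-plusE : ∀ j → chips (plusE c j) ≡ suc (chips c)
  chips-plusE j = +-cancelʳ-≡ (lookup c j) _ _ (trans (chips-updateAt j suc) (+-suc (chips c) (lookup c j)))

  chips-minusE : ∀ i → 1 ≤ lookup c i → suc (chips (minusE c i)) ≡ chips c
  chips-minusE i 1≤cᵢ = +-cancelʳ-≡ (lookup c i ∸ 1) _ _ (begin
    suc (chips (minusE c i)) + (lookup c i ∸ 1)  ≡⟨ +-suc (chips (minusE c i)) _ ⟨
    chips (minusE c i) + suc (lookup c i ∸ 1)    ≡⟨ cong (chips (minusE c i) +_) (trans (+-comm 1 _) (m∸n+n≡m 1≤cᵢ)) ⟩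
    chips (minusE c i) + lookup c i              ≡⟨ chips-updateAt i (_∸ 1) ⟩
    chips c + (lookup c i ∸ 1)                   ∎)
    where open ≡-Reasoning

move : ∀ {n} → Config n → Fin n → Fin n → Config n
move c i j = plusE (minusE c i) j

module _ {n : ℕ} (c : Config n) {i j : Fin n} where

  chips-move : 1 ≤ lookup c i → chips (move c i j) ≡ chips c
  chips-move 1≤cᵢ = trans (chips-plusE (minusE c i) j) (chips-minusE c i 1≤cᵢ)

  move-≥-minusE : ∀ v → lookup (minusE c i) v ≤ lookup (move c i j) v
  move-≥-minusE = plusE-≥ (minusE c i) j

  lookup-move-source : i ≢ j → lookup (move c i j) i ≡ lookup c i ∸ 1
  lookup-move-source i≢j = trans (lookup-plusE-other (minusE c i) j i≢j) (lookup-minusE-self c i)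

  lookup-move-target : i ≢ j → lookup (move c i j) j ≡ suc (lookup c j)
  lookup-move-target i≢j = trans (lookup-plusE-self (minusE c i) j) (cong suc (lookup-minusE-other c i (i≢j ∘ sym)))

  lookup-move-other : ∀ {v} → v ≢ i → v ≢ j → lookup (move c i j) v ≡ lookup c v
  lookup-move-other v≢i v≢j = trans (lookup-plusE-other (minusE c i) j v≢j) (lookup-minusE-other c i v≢i)

agreeOff⇒≡ : ∀ {n} {c d : Config n} {i} → chips c ≡ chips d → (∀ v → v ≢ i → lookup c v ≡ lookup d v) → c ≡ d
agreeOff⇒≡ {c = c} {d} {i} same-chips agreeOff = Pointwise-≡⇒≡ (ext agree)
  where
  agreeAt : lookup c i ≡ lookup d i
  agreeAt = +-cancelˡ-≡ (sum (lookup d)) _ _ (begin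
    sum (lookup d) + lookup c i  ≡⟨ sum-agreeing-off i agreeOff ⟨
    sum (lookup c) + lookup d i  ≡⟨ cong (_+ lookup d i) (trans (sym (chips≡sum c)) (trans same-chips (chips≡sum d))) ⟩
    sum (lookup d) + lookup d i  ∎)
    where open ≡-Reasoning
  agree : ∀ v → lookup c v ≡ lookup d v
  agree v with v F.≟ i
  ... | yes refl = agreeAt
  ... | no v≢i   = agreeOff v v≢i

pred+suc : ∀ {x} → 1 ≤ x → (x ∸ 1) + suc x ≡ x + x
pred+suc {suc x} _ = +-suc x (suc x)

move-there-and-back : ∀ {n} (c : Config n) {i j} → 1 ≤ lookup c i → 1 ≤ lookup c j → i ≢ j →
                      ∀ v → lookup (move c i j) v + lookup (move c j i) v ≡ lookup c v + lookup c v
move-there-and-back c {i} {j} 1≤cᵢ 1≤cⱼ i≢j v with v F.≟ i | v F.≟ j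
... | yes refl | yes refl = ⊥-elim (i≢j refl)
... | yes refl | no _     = trans (cong₂ _+_ (lookup-move-source c i≢j) (lookup-move-target c (i≢j ∘ sym))) (pred+suc 1≤cᵢ)
... | no _     | yes refl = trans (cong₂ _+_ (lookup-move-target c i≢j) (lookup-move-source c (i≢j ∘ sym)))
                                  (trans (+-comm (suc (lookup c v)) _) (pred+suc 1≤cⱼ))
... | no v≢i   | no v≢j   = cong₂ _+_ (lookup-move-other c v≢i v≢j) (lookup-move-other c v≢j v≢i)

module _ {n : ℕ} (G : Graph n) (v₀ : Fin n) where

  selfReachable-mono : Connected G → ∀ {c d} → (∀ v → lookup c v ≤ lookup d v) → SelfReachable G c → SelfReachable G d
  selfReachable-mono connected c≤d sr = schedule⇒selfReachable G v₀
    (record { rank = rank ; rank-injective = rank-injective ; supported = λ v → ≤-trans (supported v) (c≤d v) })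
    where
    S = selfReachable⇒schedule G connected sr
    open Schedule S

  slack⇒removable : ∀ {c} (S : Schedule G c) {v} → outdeg G (Schedule.rank S) v < lookup c v → RemovableAt G c v
  slack⇒removable {c} S {v} slack = ≤-trans (s≤s z≤n) slack , schedule⇒selfReachable G v₀
    (record { rank = rank ; rank-injective = rank-injective ; supported = supported′ })
    where
    open Schedule S
    supported′ : ∀ w → outdeg G rank w ≤ lookup (minusE c v) w
    supported′ w with w F.≟ v
    ... | yes refl = ≤-trans (<⇒≤pred slack) (≤-reflexive (sym (lookup-minusE-self c w)))
    ... | no w≢v   = ≤-trans (supported w) (≤-reflexive (sym (lookup-minusE-other c v w≢v)))

  slack-exists : IsTree G → ∀ {c} (S : Schedule G c) → n ≤ chips c → ∃[ v ] outdeg G (Schedule.rank S) v < lookup c v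
  slack-exists (connected , acyclic) {c} S n≤chips with any? (λ v → outdeg G (Schedule.rank S) v <? lookup c v)
  ... | yes slack  = slack
  ... | no noSlack = ⊥-elim (≤⇒≯ n≤chips (begin-strict
    chips c              ≡⟨ chips≡sum c ⟩
    sum (lookup c)       ≤⟨ sum-mono-≤ (λ v → ≮⇒≥ λ slack → noSlack (v , slack)) ⟩
    sum (outdeg G rank)  <⟨ Rooted.sum-outdeg< G connected v₀ acyclic rank-injective ⟩
    n                    ∎))
    where
    open Schedule S
    open ≤-Reasoning

-- Near-minimal configurations

module _ {n : ℕ} (D : Fin n → Bool) (rank : Fin n → ℕ) where

  liftOn : Fin n → ℕ
  liftOn v = (if D v then suc (sum rank) else 0) + rank v

  liftOn-above : ∀ {v w} → D v ≡ true → D w ≡ false → liftOn w < liftOn v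
  liftOn-above {v} {w} Dv Dw rewrite Dv | Dw = s≤s (≤-trans (≤-sum rank w) (m≤m+n _ (rank v)))

  liftOn-precedes : ∀ {v w} → D v ≡ D w → ⌊ liftOn v <? liftOn w ⌋ ≡ ⌊ rank v <? rank w ⌋
  liftOn-precedes {v} {w} Dv≡Dw with D v | D w
  ... | false | false = refl
  ... | true  | true  = ⌊+-<?⌋ (suc (sum rank)) (rank v) (rank w)

  liftOn-injective : Injective _≡_ _≡_ rank → Injective _≡_ _≡_ liftOn
  liftOn-injective rank-injective {v} {w} eq with true-or-false (D v) | true-or-false (D w)
  ... | inj₁ Dv | inj₂ Dw = ⊥-elim (<-irrefl (sym eq) (liftOn-above Dv Dw))
  ... | inj₂ Dv | inj₁ Dw = ⊥-elim (<-irrefl eq (liftOn-above Dw Dv))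
  ... | inj₁ Dv | inj₁ Dw rewrite Dv | Dw = rank-injective (+-cancelˡ-≡ (suc (sum rank)) _ _ eq)
  ... | inj₂ Dv | inj₂ Dw rewrite Dv | Dw = rank-injective eq

select-min : ∀ x y (b : Bool) → (if ⌊ x <? y ⌋ then x else y) ≤ (if b then x else y)
select-min x y b with x <? y | b
... | yes _   | true  = ≤-refl
... | yes x<y | false = <⇒≤ x<y
... | no x≮y  | true  = ≮⇒≥ x≮y
... | no _    | false = ≤-refl

select-min-rigid : ∀ {x y} (b : Bool) → x ≢ y → (if ⌊ x <? y ⌋ then x else y) ≡ (if b then x else y) → b ≡ ⌊ x <? y ⌋
select-min-rigid {x} {y} b x≢y eq with x <? y | b
... | yes _ | true  = refl
... | yes _ | false = ⊥-elim (x≢y eq)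
... | no _  | true  = ⊥-elim (x≢y (sym eq))
... | no _  | false = refl

module Weighted {n : ℕ} (G : Graph n) (ω : Fin n → ℕ) where

  weightedOutdeg : (Fin n → ℕ) → ℕ
  weightedOutdeg κ = sum λ v → ω v * outdeg G κ v

  arcCost : (Fin n → ℕ) → Fin n → Fin n → ℕ
  arcCost κ v w = ω v * χ (adj G v w ∧ ⌊ κ v <? κ w ⌋)

  edgeCost : (Fin n → ℕ) → Fin n → Fin n → ℕ
  edgeCost κ v w = arcCost κ v w + arcCost κ w v

  -- Every edge is charged once from each of its endpoints.
  edgeCost-total : ∀ κ → 2 * weightedOutdeg κ ≡ sum λ v → sum λ w → edgeCost κ v w
  edgeCost-total κ = begin
    2 * weightedOutdeg κ                                           ≡⟨ cong (weightedOutdeg κ +_) (+-identityʳ _) ⟩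
    weightedOutdeg κ + weightedOutdeg κ                            ≡⟨ cong₂ _+_ arcs arcs ⟩
    sum (λ v → sum (arcCost κ v)) + sum (λ v → sum (arcCost κ v))  ≡⟨ ℕ∑.∑-distrib-+ (λ v → sum (arcCost κ v)) _ ⟨
    sum (λ v → sum (arcCost κ v) + sum (arcCost κ v))              ≡⟨ sum-cong-≗ (λ v → ℕ∑.∑-distrib-+ (arcCost κ v) (arcCost κ v)) ⟨
    sum (λ v → sum λ w → arcCost κ v w + arcCost κ v w)            ≡⟨ sum-transpose-right (arcCost κ) (arcCost κ) ⟨
    sum (λ v → sum λ w → edgeCost κ v w)                           ∎
    where
    open ≡-Reasoning
    arcs : weightedOutdeg κ ≡ sum (λ v → sum (arcCost κ v))
    arcs = sum-cong-≗ λ v → ℕ∑.*-distribˡ-sum {n} (ω v) (λ w → χ (adj G v w ∧ ⌊ κ v <? κ w ⌋))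

  edgeCost-nonadjacent : ∀ κ {v w} → adj G v w ≡ false → edgeCost κ v w ≡ 0
  edgeCost-nonadjacent κ {v} {w} v≁w rewrite v≁w | trans (adj-sym G w v) v≁w = cong₂ _+_ (*-zeroʳ (ω v)) (*-zeroʳ (ω w))

  edgeCost-adjacent : ∀ {κ} → Injective _≡_ _≡_ κ → ∀ {v w} → Adj G v w →
                      edgeCost κ v w ≡ (if ⌊ κ v <? κ w ⌋ then ω v else ω w)
  edgeCost-adjacent {κ} κ-injective {v} {w} v~w rewrite v~w | Adj-sym G v~w with <-cmp (κ v) (κ w)
  ... | tri< v<w _ w≮v rewrite ⌊⌋-yes (κ v <? κ w) v<w | ⌊⌋-no (κ w <? κ v) w≮v = trans (cong₂ _+_ (*-identityʳ (ω v)) (*-zeroʳ (ω w))) (+-identityʳ _)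
  ... | tri> v≮w _ w<v rewrite ⌊⌋-no (κ v <? κ w) v≮w | ⌊⌋-yes (κ w <? κ v) w<v = cong₂ _+_ (*-zeroʳ (ω v)) (*-identityʳ (ω w))
  ... | tri≈ _ v≡w _ = ⊥-elim (Adj⇒≢ G v~w (κ-injective v≡w))

  module _ (ω-injective : Injective _≡_ _≡_ ω) {κ : Fin n → ℕ} (κ-injective : Injective _≡_ _≡_ κ) where

    edgeCost-minimal : ∀ v w → edgeCost ω v w ≤ edgeCost κ v w
    edgeCost-minimal v w with true-or-false (adj G v w)
    ... | inj₁ v~w = subst₂ _≤_ (sym (edgeCost-adjacent ω-injective v~w)) (sym (edgeCost-adjacent κ-injective v~w)) (select-min (ω v) (ω w) _)
    ... | inj₂ v≁w = ≤-reflexive (trans (edgeCost-nonadjacent ω v≁w) (sym (edgeCost-nonadjacent κ v≁w)))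

    edgeCost-rigid : ∀ {v w} → Adj G v w → edgeCost ω v w ≡ edgeCost κ v w → ⌊ κ v <? κ w ⌋ ≡ ⌊ ω v <? ω w ⌋
    edgeCost-rigid {v} {w} v~w eq = select-min-rigid _ (Adj⇒≢ G v~w ∘ ω-injective)
      (trans (sym (edgeCost-adjacent ω-injective v~w)) (trans eq (edgeCost-adjacent κ-injective v~w)))

    weightedOutdeg-minimal : weightedOutdeg ω ≤ weightedOutdeg κ
    weightedOutdeg-minimal = *-cancelˡ-≤ 2 (begin
      2 * weightedOutdeg ω                  ≡⟨ edgeCost-total ω ⟩
      sum (λ v → sum λ w → edgeCost ω v w)  ≤⟨ sum-mono-≤ (λ v → sum-mono-≤ (edgeCost-minimal v)) ⟩
      sum (λ v → sum λ w → edgeCost κ v w)  ≡⟨ edgeCost-total κ ⟨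
      2 * weightedOutdeg κ                  ∎)
      where open ≤-Reasoning

    weightedOutdeg-rigid : weightedOutdeg κ ≤ weightedOutdeg ω → ∀ v → outdeg G κ v ≡ outdeg G ω v
    weightedOutdeg-rigid κ≤ω v = sum-cong-≗ sameArc
      where
      totals : sum (λ v → sum λ w → edgeCost κ v w) ≤ sum (λ v → sum λ w → edgeCost ω v w)
      totals = subst₂ _≤_ (edgeCost-total κ) (edgeCost-total ω) (*-monoʳ-≤ 2 κ≤ω)
      rows : ∀ v → sum (edgeCost ω v) ≡ sum (edgeCost κ v)
      rows = sum-rigid (λ v → sum-mono-≤ (edgeCost-minimal v)) totals
      sameArc : ∀ w → χ (adj G v w ∧ ⌊ κ v <? κ w ⌋) ≡ χ (adj G v w ∧ ⌊ ω v <? ω w ⌋)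
      sameArc w with true-or-false (adj G v w)
      ... | inj₁ v~w = cong (λ b → χ (adj G v w ∧ b))
                            (edgeCost-rigid v~w (sum-rigid (edgeCost-minimal v) (≤-reflexive (sym (rows v))) w))
      ... | inj₂ v≁w rewrite v≁w = refl

  weightedChips : Config n → ℕ
  weightedChips c = sum λ v → ω v * lookup c v

  weightedOutdeg≤weightedChips : ∀ {c} (S : Schedule G c) → weightedOutdeg (Schedule.rank S) ≤ weightedChips c
  weightedOutdeg≤weightedChips S = sum-mono-≤ λ v → *-monoʳ-≤ (ω v) (Schedule.supported S v)

module NearMinimal {n : ℕ} (T : Graph n) (tree : IsTree T) {ν : Config n} {i : Fin n}
                   (removable : RemovableAt T ν i) (onlyI : ∀ j → RemovableAt T ν j → j ≡ i) where

  private
    connected : Connected T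
    connected = tree .proj₁

    acyclic : ¬ HasCycle T
    acyclic = tree .proj₂

  open Schedule (selfReachable⇒schedule T connected (removable .proj₂))

  supports-ν : ∀ v → outdeg T rank v ≤ lookup ν v
  supports-ν v = ≤-trans (supported v) (minusE-≤ ν i v)

  tight : ∀ v → v ≢ i → outdeg T rank v ≡ lookup ν v
  tight v v≢i with outdeg T rank v <? lookup ν v
  ... | no ¬slack = ≤-antisym (supports-ν v) (≮⇒≥ ¬slack)
  ... | yes slack = ⊥-elim (v≢i (onlyI v (slack⇒removable T i schedule slack)))
    where
    schedule : Schedule T ν
    schedule = record { rank = rank ; rank-injective = rank-injective ; supported = supports-ν }

  private
    arc : (Fin n → ℕ) → Fin n → Fin n → ℕ
    arc κ v w = χ (adj T v w ∧ ⌊ κ v <? κ w ⌋)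

    indicator : Fin n → Fin n → ℕ
    indicator u w = if does (w F.≟ u) then 1 else 0

  -- If a neighbour j of i were ranked below i, lifting the branch at j above everything would make j removable.
  module _ {j : Fin n} (j~i : Adj T j i) (j<i : rank j < rank i) where
    open Rooted T connected i using (inSubtree; inSubtree-self; inSubtree-root; leaving-subtree)

    private
      branch : Fin n → Bool
      branch = inSubtree j

      lifted : Fin n → ℕ
      lifted = liftOn branch rank

      j≢i : j ≢ i
      j≢i = Adj⇒≢ T j~i

      branch-j : branch j ≡ true
      branch-j = inSubtree-self j

      branch-i : branch i ≡ false
      branch-i = inSubtree-root j≢i

      crossing : ∀ {u w} → Adj T u w → branch u ≡ true → branch w ≡ false → u ≡ j × w ≡ i
      crossing = leaving-subtree acyclic j~i

      sameSide : ∀ {v w} → Adj T v w → ¬ (v ≡ j × w ≡ i) → ¬ (v ≡ i × w ≡ j) → branch v ≡ branch w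
      sameSide {v} {w} v~w not-ji not-ij with true-or-false (branch v) | true-or-false (branch w)
      ... | inj₁ bv | inj₁ bw = trans bv (sym bw)
      ... | inj₂ bv | inj₂ bw = trans bv (sym bw)
      ... | inj₁ bv | inj₂ bw = ⊥-elim (not-ji (crossing v~w bv bw))
      ... | inj₂ bv | inj₁ bw = ⊥-elim (not-ij (Product.swap (crossing (Adj-sym T v~w) bw bv)))

      arc-kept : ∀ {v w} → ¬ (v ≡ j × w ≡ i) → ¬ (v ≡ i × w ≡ j) → arc lifted v w ≡ arc rank v w
      arc-kept {v} {w} not-ji not-ij with true-or-false (adj T v w)
      ... | inj₁ v~w = cong (λ b → χ (adj T v w ∧ b)) (liftOn-precedes branch rank (sameSide v~w not-ji not-ij))
      ... | inj₂ v≁w rewrite v≁w = refl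

      arc-at-i : ∀ w → arc lifted i w ≤ arc rank i w + indicator j w
      arc-at-i w with w F.≟ j
      ... | yes refl = ≤-trans (χ≤1 _) (m≤n+m 1 _)
      ... | no w≢j   = ≤-trans (≤-reflexive (arc-kept (j≢i ∘ sym ∘ proj₁) (w≢j ∘ proj₂))) (m≤m+n _ _)

      arc-at-j : ∀ w → arc lifted j w + indicator i w ≤ arc rank j w
      arc-at-j w with w F.≟ i
      ... | yes refl rewrite j~i | ⌊⌋-no (lifted j <? lifted w) (<-asym (liftOn-above branch rank branch-j branch-i))
                           | ⌊⌋-yes (rank j <? rank w) j<i = ≤-refl
      ... | no w≢i   = ≤-reflexive (trans (+-identityʳ _) (arc-kept (w≢i ∘ proj₂) (j≢i ∘ proj₁)))

      outdeg-at-i : outdeg T lifted i ≤ outdeg T rank i + 1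
      outdeg-at-i = begin
        outdeg T lifted i                         ≤⟨ sum-mono-≤ arc-at-i ⟩
        sum (λ w → arc rank i w + indicator j w)  ≡⟨ ℕ∑.∑-distrib-+ (arc rank i) (indicator j) ⟩
        outdeg T rank i + sum (indicator j)       ≡⟨ cong (outdeg T rank i +_) (sum-pick j (λ _ → 1)) ⟩
        outdeg T rank i + 1                       ∎
        where open ≤-Reasoning

      outdeg-at-j : outdeg T lifted j + 1 ≤ outdeg T rank j
      outdeg-at-j = begin
        outdeg T lifted j + 1                       ≡⟨ cong (outdeg T lifted j +_) (sum-pick i (λ _ → 1)) ⟨
        outdeg T lifted j + sum (indicator i)       ≡⟨ ℕ∑.∑-distrib-+ (arc lifted j) (indicator i) ⟨
        sum (λ w → arc lifted j w + indicator i w)  ≤⟨ sum-mono-≤ arc-at-j ⟩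
        outdeg T rank j                             ∎
        where open ≤-Reasoning

      outdeg-elsewhere : ∀ {v} → v ≢ j → v ≢ i → outdeg T lifted v ≡ outdeg T rank v
      outdeg-elsewhere v≢j v≢i = sum-cong-≗ {n} λ w → arc-kept (v≢j ∘ proj₁) (v≢i ∘ proj₁)

      lifted-supports : ∀ v → outdeg T lifted v ≤ lookup (minusE ν j) v
      lifted-supports v with v F.≟ j | v F.≟ i
      ... | yes refl | _      = ≤-trans (m+n≤o⇒m≤o∸n _ (≤-trans outdeg-at-j (supports-ν v))) (≤-reflexive (sym (lookup-minusE-self ν v)))
      ... | no v≢j  | yes refl = ≤-trans outdeg-at-i (≤-trans (+-monoˡ-≤ 1 (supported v)) (≤-reflexive
                        (trans (cong (_+ 1) (lookup-minusE-self ν v)) (trans (m∸n+n≡m (removable .proj₁)) (sym (lookup-minusE-other ν j v≢j))))))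
      ... | no v≢j  | no v≢i   = ≤-trans (≤-reflexive (outdeg-elsewhere v≢j v≢i))
                                   (≤-trans (supports-ν v) (≤-reflexive (sym (lookup-minusE-other ν j v≢j))))

    lower-neighbour-removable : RemovableAt T ν j
    lower-neighbour-removable = ≤-trans (m≤n+m 1 _) (≤-trans outdeg-at-j (supports-ν j))
                , schedule⇒selfReachable T i (record
                    { rank = lifted ; rank-injective = liftOn-injective branch rank rank-injective ; supported = lifted-supports })

  precedes-neighbours : ∀ {w} → Adj T i w → rank i < rank w
  precedes-neighbours {w} i~w with <-cmp (rank i) (rank w)
  ... | tri< i<w _ _ = i<w
  ... | tri≈ _ i≡w _ = ⊥-elim (Adj⇒≢ T i~w (rank-injective i≡w))
  ... | tri> _ _ w<i = ⊥-elim (Adj⇒≢ T i~w (sym (onlyI w (lower-neighbour-removable (Adj-sym T i~w) w<i))))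

  weight : Fin n → ℕ
  weight v = if does (v F.≟ i) then 0 else suc (rank v)

  weight-i : weight i ≡ 0
  weight-i = cong (λ b → if b then 0 else suc (rank i)) (≟-refl i)

  weight-other : ∀ {v} → v ≢ i → weight v ≡ suc (rank v)
  weight-other {v} v≢i = cong (λ b → if b then 0 else suc (rank v)) (≟-≢ v≢i)

  weight-injective : Injective _≡_ _≡_ weight
  weight-injective {v} {w} eq with v F.≟ i | w F.≟ i
  ... | yes v≡i | yes w≡i = trans v≡i (sym w≡i)
  ... | no _    | no _    = rank-injective (suc-injective eq)

  weight-tight : ∀ v → v ≢ i → outdeg T weight v ≡ lookup ν v
  weight-tight v v≢i = trans (sum-cong-≗ sameArc) (tight v v≢i)
    where
    sameArc : ∀ w → χ (adj T v w ∧ ⌊ weight v <? weight w ⌋) ≡ χ (adj T v w ∧ ⌊ rank v <? rank w ⌋)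
    sameArc w with true-or-false (adj T v w) | w F.≟ i
    ... | inj₂ v≁w | _        rewrite v≁w = refl
    ... | inj₁ v~w | yes refl rewrite v~w | ⌊⌋-no (rank v <? rank w) (<-asym (precedes-neighbours (Adj-sym T v~w))) = refl
    ... | inj₁ v~w | no w≢i   rewrite weight-other v≢i = cong (λ b → χ (adj T v w ∧ b)) (⌊+-<?⌋ 1 (rank v) (rank w))

  open Weighted T weight

  weightedChips-ν : weightedChips ν ≡ weightedOutdeg weight
  weightedChips-ν = sum-cong-≗ λ v → byCases v (v F.≟ i)
    where
    byCases : ∀ v → Dec (v ≡ i) → weight v * lookup ν v ≡ weight v * outdeg T weight v
    byCases v (yes refl) = trans (cong (_* lookup ν v) weight-i) (sym (cong (_* outdeg T weight v) weight-i))
    byCases v (no v≢i)   = cong (weight v *_) (sym (weight-tight v v≢i))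

  weightedChips-minimal : ∀ {c} → SelfReachable T c → weightedChips ν ≤ weightedChips c
  weightedChips-minimal {c} sr = begin
    weightedChips ν        ≡⟨ weightedChips-ν ⟩
    weightedOutdeg weight  ≤⟨ weightedOutdeg-minimal weight-injective κ.rank-injective ⟩
    weightedOutdeg κ.rank  ≤⟨ weightedOutdeg≤weightedChips κ ⟩
    weightedChips c        ∎
    where
    κ = selfReachable⇒schedule T connected sr
    module κ = Schedule κ
    open ≤-Reasoning

  weightedChips-agreeOff : ∀ {c} → SelfReachable T c → weightedChips c ≤ weightedChips ν → ∀ v → v ≢ i → lookup c v ≡ lookup ν v
  weightedChips-agreeOff {c} sr c≤ν v v≢i = begin
    lookup c v         ≡⟨ *-cancelˡ-≡ _ _ (suc (rank v))
                              (subst (λ x → x * outdeg T κ.rank v ≡ x * lookup c v) (weight-other v≢i) (tightAt v)) ⟨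
    outdeg T κ.rank v  ≡⟨ sameOutdeg v ⟩
    outdeg T weight v  ≡⟨ weight-tight v v≢i ⟩
    lookup ν v         ∎
    where
    open ≡-Reasoning
    κ = selfReachable⇒schedule T connected sr
    module κ = Schedule κ
    chips≤outdeg : weightedChips c ≤ weightedOutdeg κ.rank
    chips≤outdeg = ≤-trans c≤ν (≤-trans (≤-reflexive weightedChips-ν) (weightedOutdeg-minimal weight-injective κ.rank-injective))
    sameOutdeg : ∀ v → outdeg T κ.rank v ≡ outdeg T weight v
    sameOutdeg = weightedOutdeg-rigid weight-injective κ.rank-injective
                   (≤-trans (weightedOutdeg≤weightedChips κ) (≤-trans c≤ν (≤-reflexive weightedChips-ν)))
    tightAt : ∀ v → weight v * outdeg T κ.rank v ≡ weight v * lookup c v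
    tightAt = sum-rigid (λ v → *-monoʳ-≤ (weight v) (κ.supported v)) chips≤outdeg

  weightedChips-unique : ∀ {c} → SelfReachable T c → chips c ≡ chips ν → weightedChips c ≤ weightedChips ν → c ≡ ν
  weightedChips-unique sr same-chips c≤ν = agreeOff⇒≡ same-chips (weightedChips-agreeOff sr c≤ν)

-- Convex hulls in ℚⁿ

⟦_⟧ᵘ : ℕ → ℚᵘ
⟦ k ⟧ᵘ = mkℚᵘ (ℤ.+ k) 0

-- toℚ k is literally fromℚᵘ ⟦ k ⟧ᵘ, so its arithmetic can be done in ℚᵘ.
toℚᵘ-toℚ : ∀ k → toℚᵘ (toℚ k) ≃ᵘ ⟦ k ⟧ᵘ
toℚᵘ-toℚ k = QP.toℚᵘ-fromℚᵘ ⟦ k ⟧ᵘ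

toℚ-+ : ∀ a b → toℚ (a + b) ≡ toℚ a Q.+ toℚ b
toℚ-+ a b = QP.toℚᵘ-injective (ℚᵘP.≃-trans (toℚᵘ-toℚ (a + b)) (ℚᵘP.≃-trans (*≡* eq)
  (ℚᵘP.≃-sym (ℚᵘP.≃-trans (QP.toℚᵘ-homo-+ (toℚ a) (toℚ b)) (ℚᵘP.+-cong (toℚᵘ-toℚ a) (toℚᵘ-toℚ b))))))
  where
  rearrange : ∀ x y → (x ℤ.+ y) ℤ.* ℤ.+ 1 ≡ (x ℤ.* ℤ.+ 1 ℤ.+ y ℤ.* ℤ.+ 1) ℤ.* ℤ.+ 1
  rearrange = ℤ-solve-∀
  eq : ℤ.+ (a + b) ℤ.* ℤ.+ 1 ≡ (ℤ.+ a ℤ.* ℤ.+ 1 ℤ.+ ℤ.+ b ℤ.* ℤ.+ 1) ℤ.* ℤ.+ 1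
  eq = trans (cong (ℤ._* ℤ.+ 1) (ℤP.pos-+ a b)) (rearrange (ℤ.+ a) (ℤ.+ b))

toℚ-* : ∀ a b → toℚ (a * b) ≡ toℚ a Q.* toℚ b
toℚ-* a b = QP.toℚᵘ-injective (ℚᵘP.≃-trans (toℚᵘ-toℚ (a * b)) (ℚᵘP.≃-trans (*≡* (cong (ℤ._* ℤ.+ 1) (ℤP.pos-* a b)))
  (ℚᵘP.≃-sym (ℚᵘP.≃-trans (QP.toℚᵘ-homo-* (toℚ a) (toℚ b)) (ℚᵘP.*-cong (toℚᵘ-toℚ a) (toℚᵘ-toℚ b))))))

toℚ-mono-≤ : ∀ {a b} → a ≤ b → toℚ a Q.≤ toℚ b
toℚ-mono-≤ {a} {b} a≤b = QP.toℚᵘ-cancel-≤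
  (ℚᵘP.≤-respˡ-≃ (ℚᵘP.≃-sym (toℚᵘ-toℚ a)) (ℚᵘP.≤-respʳ-≃ (ℚᵘP.≃-sym (toℚᵘ-toℚ b))
    (*≤* (ℤP.*-monoʳ-≤-nonNeg (ℤ.+ 1) (ℤ.+≤+ a≤b)))))

toℚ-cancel-≤ : ∀ {a b} → toℚ a Q.≤ toℚ b → a ≤ b
toℚ-cancel-≤ {a} {b} le with ℚᵘP.≤-respˡ-≃ (toℚᵘ-toℚ a) (ℚᵘP.≤-respʳ-≃ (toℚᵘ-toℚ b) (QP.toℚᵘ-mono-≤ le))
... | *≤* a≤b = ℤP.drop‿+≤+ (ℤP.*-cancelʳ-≤-pos (ℤ.+ a) (ℤ.+ b) (ℤ.+ 1) a≤b)

toℚ-injective : ∀ {a b} → toℚ a ≡ toℚ b → a ≡ b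
toℚ-injective eq = ≤-antisym (toℚ-cancel-≤ (QP.≤-reflexive eq)) (toℚ-cancel-≤ (QP.≤-reflexive (sym eq)))

toℚ-sum : ∀ {n} (f : Fin n → ℕ) → toℚ (sum f) ≡ ℚ∑.sum (toℚ ∘ f)
toℚ-sum {zero}  f = refl
toℚ-sum {suc n} f = trans (toℚ-+ (f zero) _) (cong (toℚ (f zero) Q.+_) (toℚ-sum (f ∘ suc)))

open +-*-Solver using (solve; _:+_; _:*_; _:-_; _:=_; con)

ℚ-+-cancelʳ-≤ : ∀ {a b} c → a Q.+ c Q.≤ b Q.+ c → a Q.≤ b
ℚ-+-cancelʳ-≤ {a} {b} c a+c≤b+c = subst₂ Q._≤_ (undo a) (undo b) (QP.+-monoˡ-≤ (Q.- c) a+c≤b+c)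
  where
  undo : ∀ x → x Q.+ c Q.- c ≡ x
  undo x = solve 2 (λ x c → x :+ c :- c := x) refl x c

ℚ-+-squeeze : ∀ {a a′ b b′} → a′ Q.≤ a → b′ Q.≤ b → a Q.+ b Q.≤ a′ Q.+ b′ → a Q.≤ a′ × b Q.≤ b′
ℚ-+-squeeze {a} {a′} {b} {b′} a′≤a b′≤b sum≤ =
  ℚ-+-cancelʳ-≤ b (QP.≤-trans sum≤ (QP.+-monoʳ-≤ a′ b′≤b)) ,
  ℚ-+-cancelʳ-≤ a (subst₂ Q._≤_ (QP.+-comm a b) (QP.+-comm a b′) (QP.≤-trans sum≤ (QP.+-monoˡ-≤ b′ a′≤a)))

ℚ-convex-pin : ∀ {m a b t} → 0ℚ Q.< t → t Q.< 1ℚ → m ≡ t Q.* a Q.+ (1ℚ Q.- t) Q.* b →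
               m Q.≤ a → m Q.≤ b → a Q.≤ m × b Q.≤ m
ℚ-convex-pin {m} {a} {b} {t} 0<t t<1 m≡ m≤a m≤b = byContradiction left , byContradiction right
  where
  0<1-t : 0ℚ Q.< 1ℚ Q.- t
  0<1-t = subst (Q._< 1ℚ Q.- t) (QP.+-inverseʳ t) (QP.+-monoˡ-< (Q.- t) t<1)
  split : m ≡ t Q.* m Q.+ (1ℚ Q.- t) Q.* m
  split = solve 2 (λ t m → m := t :* m :+ (con 1ℚ :- t) :* m) refl t m
  byContradiction : ∀ {x} → (m Q.< x → m Q.< m) → x Q.≤ m
  byContradiction {x} m<x⇒m<m with x QP.≤? m
  ... | yes x≤m = x≤m
  ... | no x≰m  = ⊥-elim (QP.<-irrefl refl (m<x⇒m<m (QP.≰⇒> x≰m)))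
  left : m Q.< a → m Q.< m
  left m<a = subst₂ Q._<_ (sym split) (sym m≡)
    (QP.+-mono-<-≤ (QP.*-monoʳ-<-pos t {{Q.positive 0<t}} m<a) (QP.*-monoˡ-≤-nonNeg (1ℚ Q.- t) {{Q.nonNegative (QP.<⇒≤ 0<1-t)}} m≤b))
  right : m Q.< b → m Q.< m
  right m<b = subst₂ Q._<_ (sym split) (sym m≡)
    (QP.+-mono-≤-< (QP.*-monoˡ-≤-nonNeg t {{Q.nonNegative (QP.<⇒≤ 0<t)}} m≤a) (QP.*-monoʳ-<-pos (1ℚ Q.- t) {{Q.positive 0<1-t}} m<b))

lookup-· : ∀ {n} t (p : Vec ℚ n) v → lookup (t · p) v ≡ t Q.* lookup p v
lookup-· t p v = lookup-map v (t Q.*_) p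

lookup-⊕ : ∀ {n} (p q : Vec ℚ n) v → lookup (p ⊕ q) v ≡ lookup p v Q.+ lookup q v
lookup-⊕ p q v = lookup-zipWith Q._+_ v p q

lookup-combo-[] : ∀ {n} v → lookup (combo {n} []) v ≡ 0ℚ
lookup-combo-[] v = lookup-replicate v 0ℚ

lookup-combo-∷ : ∀ {n} w (p : Vec ℚ n) ws v → lookup (combo ((w , p) ∷ ws)) v ≡ w Q.* lookup p v Q.+ lookup (combo ws) v
lookup-combo-∷ w p ws v = trans (lookup-⊕ (w · p) (combo ws) v) (cong (Q._+ lookup (combo ws) v) (lookup-· w p v))

module Hull {n : ℕ} (S : Vec ℚ n → Set) where

  Admissible : ℚ × Vec ℚ n → Set
  Admissible wp = (0ℚ Q.≤ proj₁ wp) × S (proj₂ wp)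

  member⇒InConv : ∀ {p} → S p → InConv S p
  member⇒InConv {p} Sp = (1ℚ , p) ∷ [] , (QP.nonNegative⁻¹ 1ℚ , Sp) ∷ [] , QP.+-identityʳ 1ℚ ,
    Pointwise-≡⇒≡ (ext λ v → sym (trans (lookup-combo-∷ 1ℚ p [] v)
      (trans (cong₂ Q._+_ (QP.*-identityˡ (lookup p v)) (lookup-combo-[] v)) (QP.+-identityʳ _))))

  weights-nonneg : ∀ {ws} → All Admissible ws → 0ℚ Q.≤ weights ws
  weights-nonneg []                  = QP.≤-refl
  weights-nonneg ((0≤w , _) ∷ adm) = QP.+-mono-≤ 0≤w (weights-nonneg adm)

  nonneg-sum-zero : ∀ {a b} → 0ℚ Q.≤ a → 0ℚ Q.≤ b → a Q.+ b ≡ 0ℚ → a ≡ 0ℚ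
  nonneg-sum-zero {a} {b} 0≤a 0≤b a+b≡0 =
    QP.≤-antisym (subst (a Q.≤_) a+b≡0 (subst (Q._≤ a Q.+ b) (QP.+-identityʳ a) (QP.+-monoʳ-≤ a 0≤b))) 0≤a

  combo-null : ∀ {ws} → All Admissible ws → weights ws ≡ 0ℚ → ∀ v → lookup (combo ws) v ≡ 0ℚ
  combo-null {[]} [] _ v = lookup-combo-[] v
  combo-null {(w , p) ∷ ws} ((0≤w , _) ∷ adm) total≡0 v = begin
    lookup (combo ((w , p) ∷ ws)) v           ≡⟨ lookup-combo-∷ w p ws v ⟩
    w Q.* lookup p v Q.+ lookup (combo ws) v  ≡⟨ cong₂ (λ a b → a Q.* lookup p v Q.+ b) w≡0 (combo-null adm rest≡0 v) ⟩
    0ℚ Q.* lookup p v Q.+ 0ℚ                  ≡⟨ solve 1 (λ x → con 0ℚ :* x :+ con 0ℚ := con 0ℚ) refl (lookup p v) ⟩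
    0ℚ                                        ∎
    where
    open ≡-Reasoning
    w≡0 = nonneg-sum-zero 0≤w (weights-nonneg adm) total≡0
    rest≡0 = nonneg-sum-zero (weights-nonneg adm) 0≤w (trans (QP.+-comm (weights ws) w) total≡0)

  scale : ℚ → List (ℚ × Vec ℚ n) → List (ℚ × Vec ℚ n)
  scale a []             = []
  scale a ((w , p) ∷ ws) = (a Q.* w , p) ∷ scale a ws

  weights-scale : ∀ a ws → weights (scale a ws) ≡ a Q.* weights ws
  weights-scale a []             = sym (QP.*-zeroʳ a)
  weights-scale a ((w , p) ∷ ws) = trans (cong (a Q.* w Q.+_) (weights-scale a ws)) (sym (QP.*-distribˡ-+ a w (weights ws)))

  combo-scale : ∀ a ws v → lookup (combo (scale a ws)) v ≡ a Q.* lookup (combo ws) v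
  combo-scale a [] v = trans (lookup-combo-[] v) (sym (trans (cong (a Q.*_) (lookup-combo-[] v)) (QP.*-zeroʳ a)))
  combo-scale a ((w , p) ∷ ws) v = begin
    lookup (combo (scale a ((w , p) ∷ ws))) v                 ≡⟨ lookup-combo-∷ (a Q.* w) p (scale a ws) v ⟩
    a Q.* w Q.* lookup p v Q.+ lookup (combo (scale a ws)) v  ≡⟨ cong (a Q.* w Q.* lookup p v Q.+_) (combo-scale a ws v) ⟩
    a Q.* w Q.* lookup p v Q.+ a Q.* lookup (combo ws) v      ≡⟨ solve 4 (λ a w x c → a :* w :* x :+ a :* c := a :* (w :* x :+ c)) refl a w (lookup p v) _ ⟩
    a Q.* (w Q.* lookup p v Q.+ lookup (combo ws) v)          ≡⟨ cong (a Q.*_) (lookup-combo-∷ w p ws v) ⟨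
    a Q.* lookup (combo ((w , p) ∷ ws)) v                     ∎
    where open ≡-Reasoning

  scale-admissible : ∀ {a ws} → 0ℚ Q.≤ a → All Admissible ws → All Admissible (scale a ws)
  scale-admissible 0≤a [] = []
  scale-admissible {a} {(w , _) ∷ _} 0≤a ((0≤w , Sp) ∷ adm) =
    (subst (Q._≤ a Q.* w) (QP.*-zeroʳ a) (QP.*-monoˡ-≤-nonNeg a {{Q.nonNegative 0≤a}} 0≤w) , Sp) ∷ scale-admissible 0≤a adm

  renormalised : ∀ ws → 0ℚ Q.< weights ws → Vec ℚ n
  renormalised ws 0<W = (1/ weights ws) {{Q.>-nonZero 0<W}} · combo ws

  renormalised-InConv : ∀ {ws} → All Admissible ws → (0<W : 0ℚ Q.< weights ws) → InConv S (renormalised ws 0<W)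
  renormalised-InConv {ws} adm 0<W = scale a ws , scale-admissible (QP.<⇒≤ (QP.positive⁻¹ a {{1/W-positive}})) adm ,
    trans (weights-scale a ws) (QP.*-inverseˡ (weights ws) {{Q.>-nonZero 0<W}}) ,
    Pointwise-≡⇒≡ (ext λ v → trans (lookup-· a (combo ws) v) (sym (combo-scale a ws v)))
    where
    a = (1/ weights ws) {{Q.>-nonZero 0<W}}
    1/W-positive = QP.1/pos⇒pos (weights ws) {{Q.positive 0<W}}

  combo-drop-null : ∀ {w} {p : Vec ℚ n} {rest : List (ℚ × Vec ℚ n)} → w ≡ 0ℚ → combo ((w , p) ∷ rest) ≡ combo rest
  combo-drop-null {w} {p} {rest} refl = Pointwise-≡⇒≡ (ext λ v → trans (lookup-combo-∷ 0ℚ p rest v)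
    (solve 2 (λ x c → con 0ℚ :* x :+ c := c) refl (lookup p v) (lookup (combo rest) v)))

  combo-only-head : ∀ {w} {p : Vec ℚ n} {rest : List (ℚ × Vec ℚ n)} →
                    All Admissible rest → w ≡ 1ℚ → weights rest ≡ 0ℚ → combo ((w , p) ∷ rest) ≡ p
  combo-only-head {w} {p} {rest} adm refl rest≡0 = Pointwise-≡⇒≡ (ext λ v → begin
    lookup (combo ((1ℚ , p) ∷ rest)) v           ≡⟨ lookup-combo-∷ 1ℚ p rest v ⟩
    1ℚ Q.* lookup p v Q.+ lookup (combo rest) v  ≡⟨ cong (1ℚ Q.* lookup p v Q.+_) (combo-null adm rest≡0 v) ⟩
    1ℚ Q.* lookup p v Q.+ 0ℚ                     ≡⟨ solve 1 (λ x → con 1ℚ :* x :+ con 0ℚ := x) refl (lookup p v) ⟩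
    lookup p v                                     ∎)
    where open ≡-Reasoning

  combo-split : ∀ {w} {p : Vec ℚ n} {rest : List (ℚ × Vec ℚ n)} → w Q.+ weights rest ≡ 1ℚ → (0<W : 0ℚ Q.< weights rest) →
                combo ((w , p) ∷ rest) ≡ (w · p) ⊕ ((1ℚ Q.- w) · renormalised rest 0<W)
  combo-split {w} {p} {rest} total 0<W = Pointwise-≡⇒≡ (ext λ v → begin
    lookup (combo ((w , p) ∷ rest)) v               ≡⟨ lookup-combo-∷ w p rest v ⟩
    w Q.* lookup p v Q.+ lookup (combo rest) v      ≡⟨ cong (w Q.* lookup p v Q.+_) (unscale v) ⟨
    w Q.* lookup p v Q.+ (1ℚ Q.- w) Q.* lookup z v  ≡⟨ cong₂ Q._+_ (lookup-· w p v) (lookup-· (1ℚ Q.- w) z v) ⟨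
    lookup (w · p) v Q.+ lookup ((1ℚ Q.- w) · z) v  ≡⟨ lookup-⊕ (w · p) ((1ℚ Q.- w) · z) v ⟨
    lookup ((w · p) ⊕ ((1ℚ Q.- w) · z)) v                  ∎)
    where
    open ≡-Reasoning
    W = weights rest
    instance
      W≢0 : Q.NonZero W
      W≢0 = Q.>-nonZero 0<W
    z = renormalised rest 0<W
    unscale : ∀ v → (1ℚ Q.- w) Q.* lookup z v ≡ lookup (combo rest) v
    unscale v = begin
      (1ℚ Q.- w) Q.* lookup z v                          ≡⟨ cong₂ Q._*_ (trans (cong (Q._- w) (sym total)) (solve 2 (λ w W → w :+ W :- w := W) refl w W))
                                                                       (lookup-· (1/ W) (combo rest) v) ⟩
      W Q.* (1/ W Q.* lookup (combo rest) v)  ≡⟨ QP.*-assoc W (1/ W) _ ⟨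
      W Q.* 1/ W Q.* lookup (combo rest) v    ≡⟨ cong (Q._* lookup (combo rest) v) (QP.*-inverseʳ W) ⟩
      1ℚ Q.* lookup (combo rest) v            ≡⟨ QP.*-identityˡ _ ⟩
      lookup (combo rest) v                   ∎

  split-merge : ∀ w (p : Vec ℚ n) → (w · p) ⊕ ((1ℚ Q.- w) · p) ≡ p
  split-merge w p = Pointwise-≡⇒≡ (ext λ v → begin
    lookup ((w · p) ⊕ ((1ℚ Q.- w) · p)) v           ≡⟨ lookup-⊕ (w · p) ((1ℚ Q.- w) · p) v ⟩
    lookup (w · p) v Q.+ lookup ((1ℚ Q.- w) · p) v  ≡⟨ cong₂ Q._+_ (lookup-· w p v) (lookup-· (1ℚ Q.- w) p v) ⟩
    w Q.* lookup p v Q.+ (1ℚ Q.- w) Q.* lookup p v  ≡⟨ solve 2 (λ w x → w :* x :+ (con 1ℚ :- w) :* x := x) refl w (lookup p v) ⟩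
    lookup p v                                       ∎)
    where open ≡-Reasoning

  -- Peel off the first point of a convex combination: it is x itself, or x lies strictly between it and the rest.
  vertex⇒member : ∀ {x} → IsVertex (InConv S) x → S x
  vertex⇒member {x} ((ws , adm , total , x≡ws) , extreme) = fromCombination ws adm total x≡ws
    where
    fromCombination : ∀ ws → All Admissible ws → weights ws ≡ 1ℚ → x ≡ combo ws → S x
    fromCombination [] [] 0≡1 _ = ⊥-elim (case cong Q.↥_ 0≡1 of λ ())
    fromCombination ((w , p) ∷ rest) ((0≤w , Sp) ∷ adm) total x≡ws with QP.<-cmp 0ℚ w | QP.<-cmp 0ℚ (weights rest)
    ... | tri> _ _ w<0 | _            = ⊥-elim (QP.<-irrefl refl (QP.<-≤-trans w<0 0≤w))
    ... | _            | tri> _ _ W<0 = ⊥-elim (QP.<-irrefl refl (QP.<-≤-trans W<0 (weights-nonneg adm)))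
    ... | tri≈ _ 0≡w _ | _            = fromCombination rest adm
          (trans (sym (QP.+-identityˡ _)) (trans (cong (Q._+ weights rest) 0≡w) total)) (trans x≡ws (combo-drop-null {w} {p} {rest} (sym 0≡w)))
    ... | tri< _ _ _   | tri≈ _ 0≡W _ = subst S (sym (trans x≡ws (combo-only-head {w} {p} {rest} adm w≡1 (sym 0≡W)))) Sp
      where
      w≡1 = trans (sym (QP.+-identityʳ w)) (trans (cong (w Q.+_) 0≡W) total)
    ... | tri< 0<w _ _ | tri< 0<W _ _ = subst S (sym x≡p) Sp
      where
      w<1 : w Q.< 1ℚ
      w<1 = subst₂ Q._<_ (QP.+-identityʳ w) total (QP.+-monoʳ-< w 0<W)
      p≡z : p ≡ renormalised rest 0<W
      p≡z = extreme p _ w (member⇒InConv Sp) (renormalised-InConv adm 0<W) 0<w w<1 (trans x≡ws (combo-split {w} {p} {rest} total 0<W))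
      x≡p : x ≡ p
      x≡p = trans x≡ws (trans (combo-split {w} {p} {rest} total 0<W)
                (trans (cong (λ z → (w · p) ⊕ ((1ℚ Q.- w) · z)) (sym p≡z)) (split-merge w p)))

⟨_,_⟩ : ∀ {n} → (Fin n → ℚ) → Vec ℚ n → ℚ
⟨ α , x ⟩ = ℚ∑.sum λ v → α v Q.* lookup x v

module _ {n : ℕ} (α : Fin n → ℚ) where

  ⟨⟩-⊕ : ∀ p q → ⟨ α , p ⊕ q ⟩ ≡ ⟨ α , p ⟩ Q.+ ⟨ α , q ⟩
  ⟨⟩-⊕ p q = trans (ℚ∑.sum-cong-≗ λ v → trans (cong (α v Q.*_) (lookup-⊕ p q v)) (QP.*-distribˡ-+ (α v) _ _))
                   (ℚ∑.∑-distrib-+ (λ v → α v Q.* lookup p v) (λ v → α v Q.* lookup q v))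

  ⟨⟩-· : ∀ t p → ⟨ α , t · p ⟩ ≡ t Q.* ⟨ α , p ⟩
  ⟨⟩-· t p = trans (ℚ∑.sum-cong-≗ λ v → trans (cong (α v Q.*_) (lookup-· t p v))
                                            (solve 3 (λ a t x → a :* (t :* x) := t :* (a :* x)) refl (α v) t (lookup p v)))
                   (sym (ℚ∑.*-distribˡ-sum t (λ v → α v Q.* lookup p v)))

  ⟨⟩-combo-[] : ⟨ α , combo [] ⟩ ≡ 0ℚ
  ⟨⟩-combo-[] = trans (ℚ∑.sum-cong-≗ λ v → trans (cong (α v Q.*_) (lookup-combo-[] v)) (QP.*-zeroʳ (α v))) (ℚ∑.sum-replicate-zero n)

  ⟨⟩-combo-∷ : ∀ w p ws → ⟨ α , combo ((w , p) ∷ ws) ⟩ ≡ w Q.* ⟨ α , p ⟩ Q.+ ⟨ α , combo ws ⟩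
  ⟨⟩-combo-∷ w p ws = trans (⟨⟩-⊕ (w · p) (combo ws)) (cong (Q._+ ⟨ α , combo ws ⟩) (⟨⟩-· w p))

module Minimiser {n : ℕ} {S : Vec ℚ n → Set} (α : Fin n → ℚ) {x₀ : Vec ℚ n} (Sx₀ : S x₀)
                 (lower : ∀ p → S p → ⟨ α , x₀ ⟩ Q.≤ ⟨ α , p ⟩)
                 (unique : ∀ p → S p → ⟨ α , p ⟩ Q.≤ ⟨ α , x₀ ⟩ → p ≡ x₀) where
  open Hull S

  combo-lower : ∀ {ws} → All Admissible ws → weights ws Q.* ⟨ α , x₀ ⟩ Q.≤ ⟨ α , combo ws ⟩
  combo-lower [] = QP.≤-reflexive (trans (QP.*-zeroˡ ⟨ α , x₀ ⟩) (sym (⟨⟩-combo-[] α)))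
  combo-lower {(w , p) ∷ ws} ((0≤w , Sp) ∷ adm) = subst₂ Q._≤_ (sym (QP.*-distribʳ-+ ⟨ α , x₀ ⟩ w (weights ws))) (sym (⟨⟩-combo-∷ α w p ws))
    (QP.+-mono-≤ (QP.*-monoˡ-≤-nonNeg w {{Q.nonNegative 0≤w}} (lower p Sp)) (combo-lower adm))

  combo-tight : ∀ {ws} → All Admissible ws → ⟨ α , combo ws ⟩ Q.≤ weights ws Q.* ⟨ α , x₀ ⟩ → combo ws ≡ weights ws · x₀
  combo-tight [] _ = Pointwise-≡⇒≡ (ext λ v → trans (lookup-combo-[] v) (sym (trans (lookup-· 0ℚ x₀ v) (QP.*-zeroˡ (lookup x₀ v)))))
  combo-tight {(w , p) ∷ ws} ((0≤w , Sp) ∷ adm) tight = Pointwise-≡⇒≡ (ext pointwise)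
    where
    pinned = ℚ-+-squeeze (QP.*-monoˡ-≤-nonNeg w {{Q.nonNegative 0≤w}} (lower p Sp)) (combo-lower adm)
               (subst₂ Q._≤_ (⟨⟩-combo-∷ α w p ws) (QP.*-distribʳ-+ ⟨ α , x₀ ⟩ w (weights ws)) tight)
    head≡ : ∀ v → w Q.* lookup p v ≡ w Q.* lookup x₀ v
    head≡ v with QP.<-cmp 0ℚ w
    ... | tri< 0<w _ _ = cong (λ y → w Q.* lookup y v) (unique p Sp (QP.*-cancelˡ-≤-pos w {{Q.positive 0<w}} (pinned .proj₁)))
    ... | tri≈ _ 0≡w _ = subst (λ t → t Q.* lookup p v ≡ t Q.* lookup x₀ v) 0≡w (trans (QP.*-zeroˡ (lookup p v)) (sym (QP.*-zeroˡ (lookup x₀ v))))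
    ... | tri> _ _ w<0 = ⊥-elim (QP.<-irrefl refl (QP.<-≤-trans w<0 0≤w))
    pointwise : ∀ v → lookup (combo ((w , p) ∷ ws)) v ≡ lookup ((w Q.+ weights ws) · x₀) v
    pointwise v = begin
      lookup (combo ((w , p) ∷ ws)) v                   ≡⟨ lookup-combo-∷ w p ws v ⟩
      w Q.* lookup p v Q.+ lookup (combo ws) v          ≡⟨ cong₂ Q._+_ (head≡ v) (trans (cong (λ y → lookup y v) (combo-tight adm (pinned .proj₂))) (lookup-· (weights ws) x₀ v)) ⟩
      w Q.* lookup x₀ v Q.+ weights ws Q.* lookup x₀ v  ≡⟨ QP.*-distribʳ-+ (lookup x₀ v) w (weights ws) ⟨
      (w Q.+ weights ws) Q.* lookup x₀ v                ≡⟨ lookup-· (w Q.+ weights ws) x₀ v ⟨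
      lookup ((w Q.+ weights ws) · x₀) v                ∎
      where open ≡-Reasoning

  InConv-lower : ∀ {y} → InConv S y → ⟨ α , x₀ ⟩ Q.≤ ⟨ α , y ⟩
  InConv-lower (ws , adm , total , refl) = subst (Q._≤ ⟨ α , combo ws ⟩) (trans (cong (Q._* _) total) (QP.*-identityˡ _)) (combo-lower adm)

  InConv-tight : ∀ {y} → InConv S y → ⟨ α , y ⟩ Q.≤ ⟨ α , x₀ ⟩ → y ≡ x₀
  InConv-tight (ws , adm , total , refl) y≤x₀ =
    trans (combo-tight adm (subst (⟨ α , combo ws ⟩ Q.≤_) (sym (trans (cong (Q._* _) total) (QP.*-identityˡ _))) y≤x₀))
          (Pointwise-≡⇒≡ (ext λ v → trans (lookup-· (weights ws) x₀ v) (trans (cong (Q._* _) total) (QP.*-identityˡ _))))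

  minimiser⇒vertex : IsVertex (InConv S) x₀
  minimiser⇒vertex = member⇒InConv Sx₀ , λ y z t y∈ z∈ 0<t t<1 x₀≡ →
    let value≡ = trans (cong ⟨ α ,_⟩ x₀≡) (trans (⟨⟩-⊕ α (t · y) ((1ℚ Q.- t) · z)) (cong₂ Q._+_ (⟨⟩-· α t y) (⟨⟩-· α (1ℚ Q.- t) z)))
        y≤ , z≤ = ℚ-convex-pin 0<t t<1 value≡ (InConv-lower y∈) (InConv-lower z∈)
    in  trans (InConv-tight y∈ y≤) (sym (InConv-tight z∈ z≤))

-- Vertices of P_ℓ(T)

lookup-embed : ∀ {n} (c : Config n) v → lookup (embed c) v ≡ toℚ (lookup c v)
lookup-embed c v = lookup-map v toℚ c

⟨⟩-embed : ∀ {n} (ω : Fin n → ℕ) (c : Config n) → ⟨ toℚ ∘ ω , embed c ⟩ ≡ toℚ (sum λ v → ω v * lookup c v)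
⟨⟩-embed ω c = trans (ℚ∑.sum-cong-≗ λ v → trans (cong (toℚ (ω v) Q.*_) (lookup-embed c v)) (sym (toℚ-* (ω v) (lookup c v))))
                     (sym (toℚ-sum λ v → ω v * lookup c v))

embed-midpoint : ∀ {n} {a b c : Config n} → (∀ v → lookup a v + lookup b v ≡ lookup c v + lookup c v) →
                 embed c ≡ (½ · embed a) ⊕ ((1ℚ Q.- ½) · embed b)
embed-midpoint {a = a} {b} {c} a+b≡2c = Pointwise-≡⇒≡ (ext λ v → begin
  lookup (embed c) v                                     ≡⟨ lookup-embed c v ⟩
  toℚ (lookup c v)                                       ≡⟨ solve 1 (λ x → x := con ½ :* (x :+ x)) refl (toℚ (lookup c v)) ⟩
  ½ Q.* (toℚ (lookup c v) Q.+ toℚ (lookup c v))          ≡⟨ cong (½ Q.*_) (trans (sym (toℚ-+ (lookup c v) (lookup c v)))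
                                                              (trans (cong toℚ (sym (a+b≡2c v))) (toℚ-+ (lookup a v) (lookup b v)))) ⟩
  ½ Q.* (toℚ (lookup a v) Q.+ toℚ (lookup b v))          ≡⟨ QP.*-distribˡ-+ ½ (toℚ (lookup a v)) (toℚ (lookup b v)) ⟩
  ½ Q.* toℚ (lookup a v) Q.+ ½ Q.* toℚ (lookup b v)      ≡⟨ cong₂ Q._+_ (cong (½ Q.*_) (lookup-embed a v)) (cong (½ Q.*_) (lookup-embed b v)) ⟨
  ½ Q.* lookup (embed a) v Q.+ ½ Q.* lookup (embed b) v  ≡⟨ cong₂ Q._+_ (lookup-· ½ (embed a) v) (lookup-· ½ (embed b) v) ⟨
  lookup (½ · embed a) v Q.+ lookup (½ · embed b) v      ≡⟨ lookup-⊕ (½ · embed a) (½ · embed b) v ⟨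
  lookup ((½ · embed a) ⊕ ((1ℚ Q.- ½) · embed b)) v      ∎)
  where open ≡-Reasoning

module _ {n : ℕ} (T : Graph n) (tree : IsTree T) {ℓ : ℕ} {ν : Config n} (chips≡ℓ : chips ν ≡ ℓ) where

  private
    connected : Connected T
    connected = tree .proj₁

  removable-pair-splits : ∀ {i j} → RemovableAt T ν i → RemovableAt T ν j → i ≢ j → ¬ IsVertex (P T ℓ) (embed ν)
  removable-pair-splits {i} {j} (1≤νᵢ , srᵢ) (1≤νⱼ , srⱼ) i≢j (_ , extreme) = <-irrefl refl (begin-strict
    lookup ν i ∸ 1              <⟨ s≤s (m∸n≤m (lookup ν i) 1) ⟩
    suc (lookup ν i)            ≡⟨ lookup-move-target ν (i≢j ∘ sym) ⟨
    lookup (move ν j i) i       ≡⟨ same-at-i ⟨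
    lookup (move ν i j) i       ≡⟨ lookup-move-source ν i≢j ⟩
    lookup ν i ∸ 1              ∎)
    where
    open ≤-Reasoning
    moved∈P : ∀ {a b} → RemovableAt T ν a → P T ℓ (embed (move ν a b))
    moved∈P {a} {b} (1≤νₐ , srₐ) = Hull.member⇒InConv (InS T ℓ)
      (move ν a b , selfReachable-mono T a connected (move-≥-minusE ν) srₐ , trans (chips-move ν 1≤νₐ) chips≡ℓ , refl)
    midpoint : embed ν ≡ (½ · embed (move ν i j)) ⊕ ((1ℚ Q.- ½) · embed (move ν j i))
    midpoint = embed-midpoint (move-there-and-back ν 1≤νᵢ 1≤νⱼ i≢j)
    same-at-i : lookup (move ν i j) i ≡ lookup (move ν j i) i
    same-at-i = toℚ-injective (trans (sym (lookup-embed (move ν i j) i))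
      (trans (cong (λ x → lookup x i) (extreme _ _ ½ (moved∈P (1≤νᵢ , srᵢ)) (moved∈P (1≤νⱼ , srⱼ))
                                                 (from-yes (0ℚ QP.<? ½)) (from-yes (½ QP.<? 1ℚ)) midpoint))
             (lookup-embed (move ν j i) i)))

  vertex⇒nearMinimal : Fin n → n ≤ ℓ → SelfReachable T ν → IsVertex (P T ℓ) (embed ν) → NearMinSR T ν
  vertex⇒nearMinimal v₀ n≤ℓ sr vertex = i , sr , notMinimal , removableᵢ , onlyI
    where
    S = selfReachable⇒schedule T connected sr
    slack = slack-exists T v₀ tree S (subst (n ≤_) (sym chips≡ℓ) n≤ℓ)
    i = slack .proj₁
    removableᵢ = slack⇒removable T v₀ S (slack .proj₂)
    notMinimal : ¬ MinimallySelfReachable T ν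
    notMinimal (_ , chips≡n-1) = ≤⇒≯ (≤-trans n≤ℓ (≤-reflexive (trans (sym chips≡ℓ) chips≡n-1)))
                                     (∸-monoʳ-< (s≤s z≤n) (≤-trans (s≤s z≤n) (toℕ<n v₀)))
    onlyI : ∀ j → RemovableAt T ν j → j ≡ i
    onlyI j removableⱼ with j F.≟ i
    ... | yes j≡i = j≡i
    ... | no j≢i  = ⊥-elim (removable-pair-splits removableⱼ removableᵢ j≢i vertex)

  nearMinimal⇒vertex : ∀ {i} → NearMinSRAbout T ν i → IsVertex (P T ℓ) (embed ν)
  nearMinimal⇒vertex (sr , _ , removable , onlyI) = Minimiser.minimiser⇒vertex (toℚ ∘ weight) (ν , sr , chips≡ℓ , refl) lower unique
    where
    open NearMinimal T tree removable onlyI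
    open Weighted T weight using (weightedChips)
    lower : ∀ p → InS T ℓ p → ⟨ toℚ ∘ weight , embed ν ⟩ Q.≤ ⟨ toℚ ∘ weight , p ⟩
    lower _ (c , src , _ , refl) =
      subst₂ Q._≤_ (sym (⟨⟩-embed weight ν)) (sym (⟨⟩-embed weight c)) (toℚ-mono-≤ (weightedChips-minimal src))
    unique : ∀ p → InS T ℓ p → ⟨ toℚ ∘ weight , p ⟩ Q.≤ ⟨ toℚ ∘ weight , embed ν ⟩ → p ≡ embed ν
    unique _ (c , src , chips≡ , refl) c≤ν = cong embed (weightedChips-unique src (trans chips≡ (sym chips≡ℓ))
      (toℚ-cancel-≤ (subst₂ Q._≤_ (⟨⟩-embed weight c) (⟨⟩-embed weight ν) c≤ν)))

theorem5p3 : (n : ℕ) → 1 ≤ n → (T : Graph n) → IsTree T → (ℓ : ℕ) → n ≤ ℓ →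
    (x : Vec ℚ n) →
    IsVertex (P T ℓ) x ⇔ Σ (Config n) (λ ν → NearMinSR T ν × chips ν ≡ ℓ × x ≡ embed ν)
theorem5p3 (suc m) _ T tree ℓ n≤ℓ x = mk⇔ to from
  where
  to : IsVertex (P T ℓ) x → Σ (Config (suc m)) (λ ν → NearMinSR T ν × chips ν ≡ ℓ × x ≡ embed ν)
  to vertex with Hull.vertex⇒member (InS T ℓ) vertex
  ... | ν , sr , chips≡ℓ , refl = ν , vertex⇒nearMinimal T tree chips≡ℓ zero n≤ℓ sr vertex , chips≡ℓ , refl
  from : Σ (Config (suc m)) (λ ν → NearMinSR T ν × chips ν ≡ ℓ × x ≡ embed ν) → IsVertex (P T ℓ) x
  from (ν , (_ , nearMinimal) , chips≡ℓ , refl) = nearMinimal⇒vertex T tree chips≡ℓ nearMinimal
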